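{- Let $\gamma$ be a finite set of cells that is a translate of a Young diagram (French convention). For integers $e$ and $e'$, $Q^f_{(\gamma,e)}(X)=Q^f_{(\gamma,e')}(X)$. That is, the folded Q-function does not depend on the choice of the specialized diagonal.
   Context: Cells are pairs $(x,y)\in\mathbb Z^2$ (column $x$, row $y$, rows increasing upward). A folded diagram is a pair $(\gamma,e)$, where $\gamma$ is a translate of a Young diagram in French convention and $e\in\mathbb Z$ determines the specialized diagonal $\mathfrak d=\{(x,y):x-y=e\}$; this diagonal need not meet $\gamma$. A cell $(x,y)$ is weakly above $\mathfrak d$ if $x-y\le e$. A semi-standard folded tableau of shape $(\gamma,e)$ is a filling of the cells of $\gamma$ with letters of the marked alphabet $1'<1<2'<2<\cdots$ satisfying: - entries weakly increase from left to right along rows and from bottom to top along columns; - two cells in a common row that are both weakly above $\mathfrak d$ never contain the same unmarked letter; - two cells in a common row that are not both weakly above $\mathfrak d$ never contain the same marked letter; - two cells in a common column that are both weakly above $\mathfrak d$ never contain the same marked letter; - two cells in a common column that are not both weakly above $\mathfrak d$ never contain the same unmarked letter. The folded Q-function is $Q^f_{(\gamma,e)}(X)=\sum_S\prod_i x_i^{\#\{\text{cells of } S \text{ containing } i \text{ or } i'\}}$, summed over all semi-standard folded tableaux $S$ of shape $(\gamma,e)$. -}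

module Defs where

open import Data.Nat as ℕ using (ℕ; zero; suc)
open import Data.Integer as ℤ using (ℤ; +_)
open import Data.Fin using (Fin; toℕ)
open import Data.Bool using (Bool; true; false; _∧_; _∨_; not; if_then_else_)
open import Data.List using (List; []; _∷_; _++_; map; concatMap; cartesianProduct; allFin; filterᵇ; foldr; length; zip)
open import Data.List.Relation.Unary.Linked using (Linked)
open import Data.Product using (_×_; _,_; proj₁; proj₂)
open import Data.Vec using (Vec; lookup)
open import Relation.Nullary.Decidable using (⌊_⌋)

-- A partition: row lengths listed from the bottom row upwards,
-- weakly decreasing (trailing zero rows are harmless empty rows).
IsPartition : List ℕ → Set
IsPartition = Linked ℕ._≥_

Cell : Set
Cell = ℤ × ℤ          -- (column x , row y)

rowCells : ℤ → ℤ → ℕ → List Cell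
rowCells x0 y zero    = []
rowCells x0 y (suc l) = rowCells x0 y l ++ ((x0 ℤ.+ + l , y) ∷ [])

-- The translate of the Young diagram λ by (a , b):
-- cells (a + j , b + i) for i < length λ, j < λ_i (λ_0 = bottom row).
cellsOf : ℤ → ℤ → List ℕ → List Cell
cellsOf a b []      = []
cellsOf a b (l ∷ ls) = rowCells a b l ++ cellsOf a (b ℤ.+ + 1) ls

-- Marked alphabet restricted to letters 1',1,...,n',n.
-- (i , m) with i : Fin n stands for the letter (i+1)' if m = true
-- (marked) and (i+1) if m = false (unmarked).

Letter : ℕ → Set
Letter n = Fin n × Bool

-- position in the total order 1' < 1 < 2' < 2 < ...
rank : ∀ {n} → Letter n → ℕ
rank (i , m) = 2 ℕ.* toℕ i ℕ.+ (if m then 0 else 1)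

allLetters : (n : ℕ) → List (Letter n)
allLetters n = cartesianProduct (allFin n) (true ∷ false ∷ [])

allWords : (n m : ℕ) → List (List (Letter n))
allWords n zero    = [] ∷ []
allWords n (suc m) = concatMap (λ w → map (_∷ w) (allLetters n)) (allWords n m)

all : ∀ {A : Set} → (A → Bool) → List A → Bool
all p = foldr (λ x r → p x ∧ r) true

_=ℤ_ : ℤ → ℤ → Bool
x =ℤ y = ⌊ x ℤ.≟ y ⌋

_<ℤ_ : ℤ → ℤ → Bool
x <ℤ y = (x ℤ.+ + 1) ℤ.≤ᵇ y

_⇒ᵇ_ : Bool → Bool → Bool
p ⇒ᵇ q = not p ∨ q

sameLetter : ∀ {n} → Letter n → Letter n → Bool
sameLetter (i , m) (j , k) = (toℕ i ℕ.≡ᵇ toℕ j) ∧ ⌊ Data.Bool._≟_ m k ⌋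
  where import Data.Bool

marked : ∀ {n} → Letter n → Bool
marked (i , m) = m

-- cell (x , y) weakly above the specialized diagonal x - y = e
weaklyAbove : ℤ → Cell → Bool
weaklyAbove e (x , y) = (x ℤ.- y) ℤ.≤ᵇ e

pairOK : ∀ {n} → ℤ → Cell × Letter n → Cell × Letter n → Bool
pairOK e ((x₁ , y₁) , l₁) ((x₂ , y₂) , l₂) =
  (((y₁ =ℤ y₂) ∧ (x₁ <ℤ x₂)) ⇒ᵇ (rank l₁ ℕ.≤ᵇ rank l₂)) ∧
  (((x₁ =ℤ x₂) ∧ (y₁ <ℤ y₂)) ⇒ᵇ (rank l₁ ℕ.≤ᵇ rank l₂)) ∧
  (((y₁ =ℤ y₂) ∧ not (x₁ =ℤ x₂)) ⇒ᵇ
     (if both then not (sameLetter l₁ l₂ ∧ not (marked l₁))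
              else not (sameLetter l₁ l₂ ∧ marked l₁))) ∧
  (((x₁ =ℤ x₂) ∧ not (y₁ =ℤ y₂)) ⇒ᵇ
     (if both then not (sameLetter l₁ l₂ ∧ marked l₁)
              else not (sameLetter l₁ l₂ ∧ not (marked l₁))))
  where
  both : Bool
  both = weaklyAbove e (x₁ , y₁) ∧ weaklyAbove e (x₂ , y₂)

isSSFT : ∀ {n} → ℤ → List (Cell × Letter n) → Bool
isSSFT e f = all (λ p → all (pairOK e p) f) f

-- number of cells containing i or i'  (i : Fin n stands for letter i+1)
occurrences : ∀ {n} → Fin n → List (Cell × Letter n) → ℕ
occurrences i f = length (filterᵇ (λ p → toℕ (proj₁ (proj₂ p)) ℕ.≡ᵇ toℕ i) f)

hasContent : ∀ {n} → Vec ℕ n → List (Cell × Letter n) → Bool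
hasContent {n} c f = all (λ i → occurrences i f ℕ.≡ᵇ lookup c i) (allFin n)

-- For c : Vec ℕ n, QfCoeff γ e n c is the coefficient of the monomial
-- x₁^{c₁} ⋯ xₙ^{cₙ} in Q^f_{(γ,e)}(X), i.e. the number of semi-standard
-- folded tableaux of shape (γ , e) (with entries among 1',1,...,n',n)
-- having exactly c_i cells containing i or i'.  Every monomial of the
-- power series Q^f involves finitely many variables, so two folded
-- Q-functions are equal iff all these coefficients agree.

QfCoeff : List Cell → ℤ → (n : ℕ) → Vec ℕ n → ℕ
QfCoeff γ e n c =
  length (filterᵇ (λ w → let f = zip γ w in isSSFT e f ∧ hasContent c f)
                  (allWords n (length γ)))

module Submission where

-- It suffices to compare e with e + 1 (`shift-invariant⇒constant`).
-- For convex fillings the pairwise conditions of `isSSFT` are equivalent to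
-- conditions on adjacent cells only (`Local`; `valid⇒local`, `local⇒valid`).
-- Among adjacent pairs only those joining the diagonals e and e + 1 feel the
-- change of e: in such a pair of equal values one end has a forced marking
-- and the other a free one, and the roles of the two ends swap.  The toggle
-- `raise e` copies the free mark across each such pair and forces the other
-- end; `lower e` does the converse.  Both keep the values, hence the content;
-- they turn tableaux for e into tableaux for e + 1 and back (`raise-local`,
-- `lower-local`) and are mutually inverse (`lower∘raise`, `raise∘lower`).
-- That no 2×2 square carries a single value (`no-square`) keeps the
-- neighbours consulted by the toggles unambiguous.  Finally tableaux are
-- words zipped with the cell list of the diagram, and a bijection between
-- two filters of the duplicate-free list `allWords` equates their lengths
-- (`filter-bijection`), which gives `Step.step`.

open import Defs
open import Data.Nat as ℕ using (ℕ; zero; suc; _≤_; z≤n; s≤s)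
import Data.Nat.Properties as ℕP
open import Data.Integer as ℤ using (ℤ; +_; -[1+_]; +[1+_]; 1ℤ)
open import Data.Integer.Base using (pred) renaming (suc to sucℤ)
import Data.Integer.Properties as ℤP
open import Data.Integer.Tactic.RingSolver using (solve-∀)
open import Data.Fin as Fin using (Fin; toℕ)
import Data.Fin.Properties as FinP
open import Data.Bool using (Bool; true; false; T; not; _∧_; if_then_else_)
open import Data.Bool.Properties using (T-≡; ¬-not; ∧-identityʳ; ∧-zeroʳ; ∧-comm)
open import Data.Maybe as Maybe using (Maybe; just; nothing)
open import Data.List using (List; []; _∷_; _++_; map; zip; length; filterᵇ; allFin)
import Data.List.Properties as ListP
open import Data.List.Membership.Propositional using (_∈_; find)
open import Data.List.Membership.Propositional.Properties
  using (∈-∃++; ∈-++⁻; ∈-++⁺ˡ; ∈-++⁺ʳ; ∈-filter⁺; ∈-filter⁻; ∈-map⁺; ∈-map⁻;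
         ∈-concatMap⁺; ∈-concatMap⁻; ∈-cartesianProduct⁺; ∈-allFin)
open import Data.List.Relation.Unary.Any as Any using (here; there)
open import Data.List.Relation.Unary.All as All using ([]; _∷_)
import Data.List.Relation.Unary.All.Properties as AllP
open import Data.List.Relation.Unary.AllPairs as AllPairs using ([]; _∷_)
import Data.List.Relation.Unary.AllPairs.Properties as AllPairsP
import Data.List.Relation.Unary.Linked as Linked
open import Data.List.Relation.Unary.Unique.Propositional using (Unique)
import Data.List.Relation.Unary.Unique.Propositional.Properties as UniqueP
open import Data.List.Relation.Binary.Disjoint.Propositional using (Disjoint)
open import Data.Product using (_×_; _,_; proj₁; proj₂; Σ; ∃)
import Data.Product.Properties as ProductP
open import Data.Sum using (_⊎_; inj₁; inj₂)
open import Data.Empty using (⊥-elim)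
open import Data.Vec using (Vec; lookup)
open import Function using (_∘_)
open import Function.Bundles using (Equivalence)
open import Relation.Nullary using (Dec; yes; no; ¬_; does)
open import Relation.Nullary.Decidable using (isYes≗does; dec-true; dec-false; toWitness; T?)
open import Relation.Binary using (tri<; tri≈; tri>)
open import Relation.Binary.PropositionalEquality

right left up down : Cell → Cell
right (x , y) = (x ℤ.+ 1ℤ , y)
left  (x , y) = (x ℤ.- 1ℤ , y)
up    (x , y) = (x , y ℤ.+ 1ℤ)
down  (x , y) = (x , y ℤ.- 1ℤ)

diag : Cell → ℤ
diag (x , y) = x ℤ.- y

diag-right : ∀ z → diag (right z) ≡ sucℤ (diag z)
diag-right (x , y) = identity x y
  where identity : ∀ x y → (x ℤ.+ 1ℤ) ℤ.- y ≡ 1ℤ ℤ.+ (x ℤ.- y)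
        identity = solve-∀

diag-down : ∀ z → diag (down z) ≡ sucℤ (diag z)
diag-down (x , y) = identity x y
  where identity : ∀ x y → x ℤ.- (y ℤ.- 1ℤ) ≡ 1ℤ ℤ.+ (x ℤ.- y)
        identity = solve-∀

diag-left : ∀ z → sucℤ (diag (left z)) ≡ diag z
diag-left (x , y) = identity x y
  where identity : ∀ x y → 1ℤ ℤ.+ ((x ℤ.- 1ℤ) ℤ.- y) ≡ x ℤ.- y
        identity = solve-∀

diag-up : ∀ z → sucℤ (diag (up z)) ≡ diag z
diag-up (x , y) = identity x y
  where identity : ∀ x y → 1ℤ ℤ.+ (x ℤ.- (y ℤ.+ 1ℤ)) ≡ x ℤ.- y
        identity = solve-∀

private
  sub-add : ∀ x → (x ℤ.- 1ℤ) ℤ.+ 1ℤ ≡ x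
  sub-add = solve-∀
  add-sub : ∀ x → (x ℤ.+ 1ℤ) ℤ.- 1ℤ ≡ x
  add-sub = solve-∀

right-left : ∀ z → right (left z) ≡ z
right-left (x , y) = cong (_, y) (sub-add x)

left-right : ∀ z → left (right z) ≡ z
left-right (x , y) = cong (_, y) (add-sub x)

up-down : ∀ z → up (down z) ≡ z
up-down (x , y) = cong (x ,_) (sub-add y)

down-up : ∀ z → down (up z) ≡ z
down-up (x , y) = cong (x ,_) (add-sub y)

i≤i+1 : ∀ x → x ℤ.≤ x ℤ.+ 1ℤ
i≤i+1 x = ℤP.i≤i+j x 1ℤ

<-suc : ∀ t → t ℤ.< sucℤ t
<-suc t = ℤP.suc[i]≤j⇒i<j ℤP.≤-refl

≤⇒<-suc : ∀ {t e} → t ℤ.≤ e → t ℤ.< sucℤ e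
≤⇒<-suc le = ℤP.suc[i]≤j⇒i<j (ℤP.suc-mono le)

<-suc⇒≤ : ∀ {t e} → t ℤ.< sucℤ e → t ℤ.≤ e
<-suc⇒≤ {t} {e} lt = subst (t ℤ.≤_) (ℤP.pred-suc e) (ℤP.i<j⇒i≤pred[j] lt)

suc-injective : ∀ {s t} → sucℤ s ≡ sucℤ t → s ≡ t
suc-injective {s} {t} eq = trans (sym (ℤP.pred-suc s)) (trans (cong pred eq) (ℤP.pred-suc t))

-- Position of a diagonal index t relative to the two diagonals e and e + 1,
-- the only ones on which the passage from e to e + 1 changes anything.
data Band (t e : ℤ) : Set where
  before-e : t ℤ.< e → Band t e
  on-e     : t ≡ e → Band t e
  on-e+1   : t ≡ sucℤ e → Band t e
  after-e+1 : sucℤ e ℤ.< t → Band t e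

band : ∀ t e → Band t e
band t e with ℤP.<-cmp t e
... | tri< lt _ _ = before-e lt
... | tri≈ _ eq _ = on-e eq
... | tri> _ _ gt with ℤP.<-cmp t (sucℤ e)
...   | tri< lt _ _ = ⊥-elim (ℤP.≤⇒≯ (<-suc⇒≤ lt) gt)
...   | tri≈ _ eq _ = on-e+1 eq
...   | tri> _ _ gt′ = after-e+1 gt′

true≢false : true ≢ false
true≢false ()

Fill : ℕ → Set
Fill n = Cell → Maybe (Letter n)

module _ {n : ℕ} where

  value : Letter n → Fin n
  value = proj₁

  _≤ᵥ_ : Letter n → Letter n → Set
  a ≤ᵥ b = toℕ (value a) ℕ.≤ toℕ (value b)

  Filled : Fill n → Cell → Set
  Filled F z = ∃ λ l → F z ≡ just l

  -- The filled cells contain, with any two cells, the whole rectangle they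
  -- span.  Translates of Young diagrams have this property.
  Convex : Fill n → Set
  Convex F = ∀ {x y x′ y′ x″ y″} → Filled F (x″ , y″) → Filled F (x , y) →
             x″ ℤ.≤ x′ → x′ ℤ.≤ x → y″ ℤ.≤ y′ → y′ ℤ.≤ y → Filled F (x′ , y′)

  -- The conditions of a semi-standard folded tableau for the diagonal e,
  -- imposed on adjacent cells only.  If a cell and its right neighbour share a value, the left one
  -- is marked when both lie weakly above the diagonal (diag z < e), and the
  -- right one is unmarked otherwise.  If a cell and its upper neighbour share
  -- a value, the upper one is unmarked when both lie weakly above the
  -- diagonal (diag z ≤ e), and the lower one is marked otherwise.
  record Local (e : ℤ) (F : Fill n) : Set where
    field
      incRight : ∀ z {a b} → F z ≡ just a → F (right z) ≡ just b → a ≤ᵥ b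
      incUp    : ∀ z {a b} → F z ≡ just a → F (up z) ≡ just b → a ≤ᵥ b
      rowAbove : ∀ z {a b} → F z ≡ just a → F (right z) ≡ just b →
                 value a ≡ value b → diag z ℤ.< e → marked a ≡ true
      rowBelow : ∀ z {a b} → F z ≡ just a → F (right z) ≡ just b →
                 value a ≡ value b → e ℤ.≤ diag z → marked b ≡ false
      colAbove : ∀ z {a b} → F z ≡ just a → F (up z) ≡ just b →
                 value a ≡ value b → diag z ℤ.≤ e → marked b ≡ false
      colBelow : ∀ z {a b} → F z ≡ just a → F (up z) ≡ just b →
                 value a ≡ value b → e ℤ.< diag z → marked a ≡ true

  squeeze : ∀ {i j k : Fin n} → toℕ i ℕ.≤ toℕ j → toℕ j ℕ.≤ toℕ k → i ≡ k → i ≡ j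
  squeeze p q refl = FinP.toℕ-injective (ℕP.≤-antisym p q)

  -- In a convex locally folded filling no 2×2 square carries a single value:
  -- otherwise the markings forced along its four sides would contradict
  -- each other.
  no-square : ∀ {e F} → Convex F → Local e F → ∀ z {a d} →
              F z ≡ just a → F (up (right z)) ≡ just d → value a ≢ value d
  no-square {e} {F} convex local (x , y) {a} {d} fa fd a=d
    with convex {x ℤ.+ 1ℤ} {y ℤ.+ 1ℤ} {x ℤ.+ 1ℤ} {y} {x} {y} (a , fa) (d , fd)
                (i≤i+1 x) ℤP.≤-refl ℤP.≤-refl (i≤i+1 y)
       | convex {x ℤ.+ 1ℤ} {y ℤ.+ 1ℤ} {x} {y ℤ.+ 1ℤ} {x} {y} (a , fa) (d , fd)
                ℤP.≤-refl (i≤i+1 x) (i≤i+1 y) ℤP.≤-refl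
  ... | b , fb | c , fc with diag (x , y) ℤ.≤? e
  ...   | yes le = true≢false (trans (sym (rowAbove (x , y ℤ.+ 1ℤ) fc fd c=d above))
                                     (colAbove (x , y) fa fc a=c le))
    where
    open Local local
    a=c = squeeze (incUp (x , y) fa fc) (incRight (x , y ℤ.+ 1ℤ) fc fd) a=d
    c=d = trans (sym a=c) a=d
    above : diag (x , y ℤ.+ 1ℤ) ℤ.< e
    above = ℤP.suc[i]≤j⇒i<j (subst (ℤ._≤ e) (sym (diag-up (x , y))) le)
  ...   | no nle = true≢false (trans (sym (colBelow (x ℤ.+ 1ℤ , y) fb fd b=d below))
                                     (rowBelow (x , y) fa fb a=b (ℤP.<⇒≤ lt)))
    where
    open Local local
    lt = ℤP.≰⇒> nle
    a=b = squeeze (incRight (x , y) fa fb) (incUp (x ℤ.+ 1ℤ , y) fb fd) a=d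
    b=d = trans (sym a=b) a=d
    below : e ℤ.< diag (x ℤ.+ 1ℤ , y)
    below = subst (e ℤ.<_) (sym (diag-right (x , y))) (ℤP.<-trans lt (<-suc _))

  carries : Fin n → Maybe (Letter n) → Bool
  carries i nothing        = false
  carries i (just (j , _)) = does (j Fin.≟ i)

  markOf : Maybe (Letter n) → Bool
  markOf nothing        = false
  markOf (just (_ , m)) = m

  Avoids : Fill n → Cell → Fin n → Set
  Avoids F w i = ∀ b → F w ≡ just b → value b ≢ i

  carries? : ∀ (F : Fill n) w i → (∃ λ b → F w ≡ just b × value b ≡ i) ⊎ Avoids F w i
  carries? F w i with F w
  ... | nothing = inj₂ λ _ ()
  ... | just (j , m) with j Fin.≟ i
  ...   | yes j=i = inj₁ ((j , m) , refl , j=i)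
  ...   | no  j≠i = inj₂ λ { _ refl → j≠i }

  avoids⇒¬carries : ∀ {F : Fill n} {w i} → Avoids F w i → carries i (F w) ≡ false
  avoids⇒¬carries {F} {w} {i} avoid with F w | avoid
  ... | nothing    | _     = refl
  ... | just (j , m) | avoid′ = dec-false (j Fin.≟ i) (avoid′ (j , m) refl)

  Toggle : Set
  Toggle = Fill n → Cell → Letter n → Letter n

  ValuePreserving : Toggle → Set
  ValuePreserving t = ∀ F z l → value (t F z l) ≡ value l

  Extensional : Toggle → Set
  Extensional t = ∀ {F G} → (∀ z → G z ≡ F z) → ∀ z l → t G z l ≡ t F z l

  module Adjust (N₁ : Cell → Cell) (k₁ : Maybe (Letter n) → Bool)
                (N₂ : Cell → Cell) (k₂ : Maybe (Letter n) → Bool) where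

    adjust : Toggle
    adjust F z (i , m) =
      if carries i (F (N₁ z)) then (i , k₁ (F (N₁ z)))
      else if carries i (F (N₂ z)) then (i , k₂ (F (N₂ z)))
      else (i , m)

    first : ∀ F z i m {b} → F (N₁ z) ≡ just b → value b ≡ i → adjust F z (i , m) ≡ (i , k₁ (just b))
    first F z i m {j , _} fb refl rewrite fb | dec-true (j Fin.≟ j) refl = refl

    second : ∀ F z i m {b} → Avoids F (N₁ z) i → F (N₂ z) ≡ just b → value b ≡ i →
             adjust F z (i , m) ≡ (i , k₂ (just b))
    second F z i m {j , _} avoid fb refl
      rewrite avoids⇒¬carries {F} {N₁ z} avoid | fb | dec-true (j Fin.≟ j) refl = refl

    neither : ∀ F z i m → Avoids F (N₁ z) i → Avoids F (N₂ z) i → adjust F z (i , m) ≡ (i , m)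
    neither F z i m avoid₁ avoid₂
      rewrite avoids⇒¬carries {F} {N₁ z} avoid₁ | avoids⇒¬carries {F} {N₂ z} avoid₂ = refl

    preserves-value : ValuePreserving adjust
    preserves-value F z (i , m) with carries i (F (N₁ z)) | carries i (F (N₂ z))
    ... | true  | _     = refl
    ... | false | true  = refl
    ... | false | false = refl

    extensional : Extensional adjust
    extensional G=F z (i , m) rewrite G=F (N₁ z) | G=F (N₂ z) = refl

  module AtDiagonals (e : ℤ) (t₁ t₀ : Toggle) where

    toggle : Toggle
    toggle F z l =
      if does (diag z ℤ.≟ sucℤ e) then t₁ F z l
      else if does (diag z ℤ.≟ e) then t₀ F z l
      else l

    at-e+1 : ∀ F z l → diag z ≡ sucℤ e → toggle F z l ≡ t₁ F z l
    at-e+1 F z l on rewrite dec-true (diag z ℤ.≟ sucℤ e) on = refl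

    at-e : ∀ F z l → diag z ≡ e → toggle F z l ≡ t₀ F z l
    at-e F z l on
      rewrite dec-false (diag z ℤ.≟ sucℤ e) (λ on′ → ℤP.<⇒≢ (<-suc e) (trans (sym on) on′))
            | dec-true (diag z ℤ.≟ e) on = refl

    private
      off : ∀ F z l → diag z ≢ sucℤ e → diag z ≢ e → toggle F z l ≡ l
      off F z l ≢e+1 ≢e
        rewrite dec-false (diag z ℤ.≟ sucℤ e) ≢e+1 | dec-false (diag z ℤ.≟ e) ≢e = refl

    before : ∀ F z l → diag z ℤ.< e → toggle F z l ≡ l
    before F z l lt = off F z l (ℤP.<⇒≢ (ℤP.<-trans lt (<-suc e))) (ℤP.<⇒≢ lt)

    after : ∀ F z l → sucℤ e ℤ.< diag z → toggle F z l ≡ l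
    after F z l gt = off F z l (ℤP.<⇒≢ gt ∘ sym) (ℤP.<⇒≢ (ℤP.<-trans (<-suc e) gt) ∘ sym)

    preserves-value : ValuePreserving t₁ → ValuePreserving t₀ → ValuePreserving toggle
    preserves-value v₁ v₀ F z l with does (diag z ℤ.≟ sucℤ e) | does (diag z ℤ.≟ e)
    ... | true  | _     = v₁ F z l
    ... | false | true  = v₀ F z l
    ... | false | false = refl

    extensional : Extensional t₁ → Extensional t₀ → Extensional toggle
    extensional ext₁ ext₀ G=F z l =
      cong₂ (λ a b → if does (diag z ℤ.≟ sucℤ e) then a else if does (diag z ℤ.≟ e) then b else l)
            (ext₁ G=F z l) (ext₀ G=F z l)

  module FromLeftUp     = Adjust left  markOf up   markOf
  module ForceRightDown = Adjust right (λ _ → true) down (λ _ → false)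
  module ForceLeftUp    = Adjust left  (λ _ → false) up (λ _ → true)
  module FromRightDown  = Adjust right markOf down markOf

  module Raise (e : ℤ) = AtDiagonals e FromLeftUp.adjust ForceRightDown.adjust
  module Lower (e : ℤ) = AtDiagonals e ForceLeftUp.adjust FromRightDown.adjust

  raise lower : ℤ → Toggle
  raise = Raise.toggle
  lower = Lower.toggle

  raise-value : ∀ e → ValuePreserving (raise e)
  raise-value e = Raise.preserves-value e FromLeftUp.preserves-value ForceRightDown.preserves-value

  lower-value : ∀ e → ValuePreserving (lower e)
  lower-value e = Lower.preserves-value e ForceLeftUp.preserves-value FromRightDown.preserves-value

  raise-ext : ∀ e → Extensional (raise e)
  raise-ext e = Raise.extensional e FromLeftUp.extensional ForceRightDown.extensional

  lower-ext : ∀ e → Extensional (lower e)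
  lower-ext e = Lower.extensional e ForceLeftUp.extensional FromRightDown.extensional

  apply : Toggle → Fill n → Fill n
  apply t F z = Maybe.map (t F z) (F z)

  apply-just : ∀ t F z {a} → F z ≡ just a → apply t F z ≡ just (t F z a)
  apply-just t F z fa rewrite fa = refl

  apply-preimage : ∀ t F z {a′} → apply t F z ≡ just a′ → ∃ λ a → F z ≡ just a × t F z a ≡ a′
  apply-preimage t F z eq with F z
  apply-preimage t F z refl | just a = a , refl , refl

  apply-avoids : ∀ t → ValuePreserving t → ∀ {F w i} → Avoids F w i → Avoids (apply t F) w i
  apply-avoids t preserve {F} {w} avoid b′ fb′ with apply-preimage t F w fb′
  ... | b , fb , refl = λ b=i → avoid b fb (trans (sym (preserve F w b)) b=i)

  apply-increasing : ∀ t → ValuePreserving t → ∀ {F} {N : Cell → Cell} →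
    (∀ z {a b} → F z ≡ just a → F (N z) ≡ just b → a ≤ᵥ b) →
    (∀ z {a b} → apply t F z ≡ just a → apply t F (N z) ≡ just b → a ≤ᵥ b)
  apply-increasing t preserve {F} {N} inc z ga gb
    with apply-preimage t F z ga | apply-preimage t F (N z) gb
  ... | a , fa , refl | b , fb , refl
    rewrite preserve F z a | preserve F (N z) b = inc z fa fb

  Local-cong : ∀ {e} {F G : Fill n} → (∀ z → G z ≡ F z) → Local e F → Local e G
  Local-cong {e} {F} {G} G=F local = record
    { incRight = λ z ga gb → incRight z (from z ga) (from _ gb)
    ; incUp    = λ z ga gb → incUp    z (from z ga) (from _ gb)
    ; rowAbove = λ z ga gb → rowAbove z (from z ga) (from _ gb)
    ; rowBelow = λ z ga gb → rowBelow z (from z ga) (from _ gb)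
    ; colAbove = λ z ga gb → colAbove z (from z ga) (from _ gb)
    ; colBelow = λ z ga gb → colBelow z (from z ga) (from _ gb) }
    where
    open Local local
    from : ∀ z {a} → G z ≡ just a → F z ≡ just a
    from z ga = trans (sym (G=F z)) ga

module _ {n : ℕ} where

  -- Raising the diagonal: the local conditions for e become those for e + 1.
  -- Only pairs joining the diagonals e and e + 1 are affected; for them the
  -- mark freed on one end is copied to the other end, which is then forced.
  raise-local : ∀ {e} {F : Fill n} → Convex F → Local e F → Local (sucℤ e) (apply (raise e) F)
  raise-local {e} {F} convex local = record
    { incRight = apply-increasing (raise e) (raise-value e) incRight
    ; incUp    = apply-increasing (raise e) (raise-value e) incUp
    ; rowAbove = rowAbove′ ; rowBelow = rowBelow′ ; colAbove = colAbove′ ; colBelow = colBelow′ }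
    where
    open Local local
    G = apply (raise e) F

    same : ∀ z w a b → value (raise e F z a) ≡ value (raise e F w b) → value a ≡ value b
    same z w a b v = trans (sym (raise-value e F z a)) (trans v (raise-value e F w b))

    rowAbove′ : ∀ z {a b} → G z ≡ just a → G (right z) ≡ just b →
                value a ≡ value b → diag z ℤ.< sucℤ e → marked a ≡ true
    rowAbove′ z ga gb v lt with apply-preimage (raise e) F z ga | apply-preimage (raise e) F (right z) gb
    ... | (i , m) , fa , refl | b , fb , refl with band (diag z) e
    ...   | before-e p = trans (cong marked (Raise.before e F z (i , m) p))
                               (rowAbove z fa fb (same z (right z) (i , m) b v) p)
    ...   | on-e p = cong marked (trans (Raise.at-e e F z (i , m) p)
                       (ForceRightDown.first F z i m fb (sym (same z (right z) (i , m) b v))))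
    ...   | on-e+1 p = ⊥-elim (ℤP.<⇒≢ lt p)
    ...   | after-e+1 p = ⊥-elim (ℤP.<-asym lt p)

    rowBelow′ : ∀ z {a b} → G z ≡ just a → G (right z) ≡ just b →
                value a ≡ value b → sucℤ e ℤ.≤ diag z → marked b ≡ false
    rowBelow′ z ga gb v le with apply-preimage (raise e) F z ga | apply-preimage (raise e) F (right z) gb
    ... | a , fa , refl | b , fb , refl =
      trans (cong marked (Raise.after e F (right z) b after))
            (rowBelow z fa fb (same z (right z) a b v) (ℤP.<⇒≤ (ℤP.suc[i]≤j⇒i<j le)))
      where
      after : sucℤ e ℤ.< diag (right z)
      after = subst (sucℤ e ℤ.<_) (sym (diag-right z)) (ℤP.≤-<-trans le (<-suc (diag z)))

    colBelow′ : ∀ z {a b} → G z ≡ just a → G (up z) ≡ just b →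
                value a ≡ value b → sucℤ e ℤ.< diag z → marked a ≡ true
    colBelow′ z ga gb v lt with apply-preimage (raise e) F z ga | apply-preimage (raise e) F (up z) gb
    ... | a , fa , refl | b , fb , refl =
      trans (cong marked (Raise.after e F z a lt))
            (colBelow z fa fb (same z (up z) a b v) (ℤP.<-trans (<-suc e) lt))

    colAbove-unchanged : ∀ z {a b} → F z ≡ just a → F (up z) ≡ just b →
                         value a ≡ value b → diag z ℤ.≤ e → marked (raise e F (up z) b) ≡ false
    colAbove-unchanged z {b = b} fa fb v le =
      trans (cong marked (Raise.before e F (up z) b up-before)) (colAbove z fa fb v le)
      where
      up-before : diag (up z) ℤ.< e
      up-before = ℤP.suc[i]≤j⇒i<j (subst (ℤ._≤ e) (sym (diag-up z)) le)

    colAbove′ : ∀ z {a b} → G z ≡ just a → G (up z) ≡ just b →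
                value a ≡ value b → diag z ℤ.≤ sucℤ e → marked b ≡ false
    colAbove′ z ga gb v le with apply-preimage (raise e) F z ga | apply-preimage (raise e) F (up z) gb
    ... | a , fa , refl | (j , k) , fb , refl with band (diag z) e
    ...   | before-e p = colAbove-unchanged z fa fb (same z (up z) a (j , k) v) (ℤP.<⇒≤ p)
    ...   | on-e p = colAbove-unchanged z fa fb (same z (up z) a (j , k) v) (ℤP.≤-reflexive p)
    ...   | after-e+1 p = ⊥-elim (ℤP.≤⇒≯ le p)
    ...   | on-e+1 p = cong marked (trans (Raise.at-e e F (up z) (j , k) up-on-e)
                          (ForceRightDown.second F (up z) j k avoid fa′ a=j))
      where
      a=j = same z (up z) a (j , k) v
      up-on-e : diag (up z) ≡ e
      up-on-e = suc-injective (trans (diag-up z) p)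
      -- the cell right of up z cannot carry j: it would complete a square
      avoid : Avoids F (right (up z)) j
      avoid c fc c=j = no-square convex local z fa fc (trans a=j (sym c=j))
      fa′ : F (down (up z)) ≡ just a
      fa′ = trans (cong F (down-up z)) fa

  lower-local : ∀ {e} {F : Fill n} → Convex F → Local (sucℤ e) F → Local e (apply (lower e) F)
  lower-local {e} {F} convex local = record
    { incRight = apply-increasing (lower e) (lower-value e) incRight
    ; incUp    = apply-increasing (lower e) (lower-value e) incUp
    ; rowAbove = rowAbove′ ; rowBelow = rowBelow′ ; colAbove = colAbove′ ; colBelow = colBelow′ }
    where
    open Local local
    G = apply (lower e) F

    same : ∀ z w a b → value (lower e F z a) ≡ value (lower e F w b) → value a ≡ value b
    same z w a b v = trans (sym (lower-value e F z a)) (trans v (lower-value e F w b))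

    rowAbove′ : ∀ z {a b} → G z ≡ just a → G (right z) ≡ just b →
                value a ≡ value b → diag z ℤ.< e → marked a ≡ true
    rowAbove′ z ga gb v lt with apply-preimage (lower e) F z ga | apply-preimage (lower e) F (right z) gb
    ... | a , fa , refl | b , fb , refl =
      trans (cong marked (Lower.before e F z a lt))
            (rowAbove z fa fb (same z (right z) a b v) (ℤP.<-trans lt (<-suc e)))

    colAbove′ : ∀ z {a b} → G z ≡ just a → G (up z) ≡ just b →
                value a ≡ value b → diag z ℤ.≤ e → marked b ≡ false
    colAbove′ z ga gb v le with apply-preimage (lower e) F z ga | apply-preimage (lower e) F (up z) gb
    ... | a , fa , refl | b , fb , refl =
      trans (cong marked (Lower.before e F (up z) b up-before))
            (colAbove z fa fb (same z (up z) a b v) (ℤP.<⇒≤ (≤⇒<-suc le)))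
      where
      up-before : diag (up z) ℤ.< e
      up-before = ℤP.suc[i]≤j⇒i<j (subst (ℤ._≤ e) (sym (diag-up z)) le)

    rowBelow-unchanged : ∀ z {a b} → F z ≡ just a → F (right z) ≡ just b →
                         value a ≡ value b → sucℤ e ℤ.≤ diag z → marked (lower e F (right z) b) ≡ false
    rowBelow-unchanged z {b = b} fa fb v le =
      trans (cong marked (Lower.after e F (right z) b right-after)) (rowBelow z fa fb v le)
      where
      right-after : sucℤ e ℤ.< diag (right z)
      right-after = subst (sucℤ e ℤ.<_) (sym (diag-right z)) (ℤP.≤-<-trans le (<-suc (diag z)))

    rowBelow′ : ∀ z {a b} → G z ≡ just a → G (right z) ≡ just b →
                value a ≡ value b → e ℤ.≤ diag z → marked b ≡ false
    rowBelow′ z ga gb v le with apply-preimage (lower e) F z ga | apply-preimage (lower e) F (right z) gb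
    ... | a , fa , refl | (j , k) , fb , refl with band (diag z) e
    ...   | before-e p = ⊥-elim (ℤP.≤⇒≯ le p)
    ...   | on-e+1 p = rowBelow-unchanged z fa fb (same z (right z) a (j , k) v) (ℤP.≤-reflexive (sym p))
    ...   | after-e+1 p = rowBelow-unchanged z fa fb (same z (right z) a (j , k) v) (ℤP.<⇒≤ p)
    ...   | on-e p = cong marked (trans (Lower.at-e+1 e F (right z) (j , k) right-on-e+1)
                        (ForceLeftUp.first F (right z) j k fa′ (same z (right z) a (j , k) v)))
      where
      right-on-e+1 : diag (right z) ≡ sucℤ e
      right-on-e+1 = trans (diag-right z) (cong sucℤ p)
      fa′ : F (left (right z)) ≡ just a
      fa′ = trans (cong F (left-right z)) fa

    colBelow′ : ∀ z {a b} → G z ≡ just a → G (up z) ≡ just b →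
                value a ≡ value b → e ℤ.< diag z → marked a ≡ true
    colBelow′ z ga gb v lt with apply-preimage (lower e) F z ga | apply-preimage (lower e) F (up z) gb
    ... | (i , m) , fa , refl | b , fb , refl with band (diag z) e
    ...   | before-e p = ⊥-elim (ℤP.<-asym lt p)
    ...   | on-e p = ⊥-elim (ℤP.<⇒≢ lt (sym p))
    ...   | after-e+1 p = trans (cong marked (Lower.after e F z (i , m) p))
                               (colBelow z fa fb (same z (up z) (i , m) b v) p)
    ...   | on-e+1 p = cong marked (trans (Lower.at-e+1 e F z (i , m) p)
                          (ForceLeftUp.second F z i m avoid fb b=i))
      where
      b=i = sym (same z (up z) (i , m) b v)
      -- the cell left of z cannot carry i: it would complete a square
      avoid : Avoids F (left z) i
      avoid c fc c=i = no-square convex local (left z) fc (trans (cong (F ∘ up) (right-left z)) fb)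
                                 (trans c=i (sym b=i))

  lower∘raise-at-e+1 : ∀ {e} {F : Fill n} → Local e F → ∀ z {i m} → F z ≡ just (i , m) →
                       diag z ≡ sucℤ e → lower e (apply (raise e) F) z (raise e F z (i , m)) ≡ (i , m)
  lower∘raise-at-e+1 {e} {F} local z {i} {m} fa p = by-neighbours (carries? F (left z) i) (carries? F (up z) i)
    where
    open Local local
    open ≡-Reasoning
    G = apply (raise e) F
    G-avoids : ∀ {w} → Avoids F w i → Avoids G w i
    G-avoids {w} = apply-avoids (raise e) (raise-value e) {F} {w}
    by-neighbours : _ → _ → lower e G z (raise e F z (i , m)) ≡ (i , m)
    -- the left neighbour carries i: the mark of z was forced off, and is restored
    by-neighbours (inj₁ (b , fb , b=i)) _ = begin
      lower e G z (raise e F z (i , m))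
        ≡⟨ cong (lower e G z) (trans (Raise.at-e+1 e F z (i , m) p) (FromLeftUp.first F z i m fb b=i)) ⟩
      lower e G z (i , marked b)
        ≡⟨ Lower.at-e+1 e G z _ p ⟩
      ForceLeftUp.adjust G z (i , marked b)
        ≡⟨ ForceLeftUp.first G z i (marked b) (apply-just (raise e) F (left z) fb)
                             (trans (raise-value e F (left z) b) b=i) ⟩
      (i , false)
        ≡⟨ cong (i ,_) (sym m=false) ⟩
      (i , m) ∎
      where
      m=false : m ≡ false
      m=false = rowBelow (left z) fb (trans (cong F (right-left z)) fa) b=i
                         (ℤP.≤-reflexive (sym (suc-injective (trans (diag-left z) p))))
    -- only the upper neighbour carries i: the mark of z was forced on
    by-neighbours (inj₂ avoid) (inj₁ (b , fb , b=i)) = begin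
      lower e G z (raise e F z (i , m))
        ≡⟨ cong (lower e G z) (trans (Raise.at-e+1 e F z (i , m) p) (FromLeftUp.second F z i m avoid fb b=i)) ⟩
      lower e G z (i , marked b)
        ≡⟨ Lower.at-e+1 e G z _ p ⟩
      ForceLeftUp.adjust G z (i , marked b)
        ≡⟨ ForceLeftUp.second G z i (marked b) (G-avoids avoid) (apply-just (raise e) F (up z) fb)
                              (trans (raise-value e F (up z) b) b=i) ⟩
      (i , true)
        ≡⟨ cong (i ,_) (sym m=true) ⟩
      (i , m) ∎
      where
      m=true : m ≡ true
      m=true = colBelow z fa fb (sym b=i) (subst (e ℤ.<_) (sym p) (<-suc e))
    by-neighbours (inj₂ avoid₁) (inj₂ avoid₂) = begin
      lower e G z (raise e F z (i , m))
        ≡⟨ cong (lower e G z) (trans (Raise.at-e+1 e F z (i , m) p) (FromLeftUp.neither F z i m avoid₁ avoid₂)) ⟩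
      lower e G z (i , m)
        ≡⟨ Lower.at-e+1 e G z _ p ⟩
      ForceLeftUp.adjust G z (i , m)
        ≡⟨ ForceLeftUp.neither G z i m (G-avoids avoid₁) (G-avoids avoid₂) ⟩
      (i , m) ∎

  lower∘raise-at-e : ∀ {e} {F : Fill n} → Convex F → Local e F → ∀ z {i m} → F z ≡ just (i , m) →
                     diag z ≡ e → lower e (apply (raise e) F) z (raise e F z (i , m)) ≡ (i , m)
  lower∘raise-at-e {e} {F} convex local z {i} {m} fa p = by-neighbours (carries? F (right z) i) (carries? F (down z) i)
    where
    open ≡-Reasoning
    G = apply (raise e) F
    G-avoids : ∀ {w} → Avoids F w i → Avoids G w i
    G-avoids {w} = apply-avoids (raise e) (raise-value e) {F} {w}
    by-neighbours : _ → _ → lower e G z (raise e F z (i , m)) ≡ (i , m)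
    -- the right neighbour carries i: its raised mark is the old mark of z
    by-neighbours (inj₁ ((j , k) , fb , j=i)) _ = begin
      lower e G z (raise e F z (i , m))
        ≡⟨ cong (lower e G z) (trans (Raise.at-e e F z (i , m) p) (ForceRightDown.first F z i m fb j=i)) ⟩
      lower e G z (i , true)
        ≡⟨ Lower.at-e e G z _ p ⟩
      FromRightDown.adjust G z (i , true)
        ≡⟨ FromRightDown.first G z i true (apply-just (raise e) F (right z) fb)
                               (trans (raise-value e F (right z) (j , k)) j=i) ⟩
      (i , marked (raise e F (right z) (j , k)))
        ≡⟨ cong (λ l → (i , marked l)) right-raised ⟩
      (i , m) ∎
      where
      right-raised : raise e F (right z) (j , k) ≡ (j , m)
      right-raised = trans (Raise.at-e+1 e F (right z) (j , k) (trans (diag-right z) (cong sucℤ p)))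
                           (FromLeftUp.first F (right z) j k (trans (cong F (left-right z)) fa) (sym j=i))
    -- only the lower neighbour carries i: its raised mark is the old mark of z
    by-neighbours (inj₂ avoid) (inj₁ ((j , k) , fb , j=i)) = begin
      lower e G z (raise e F z (i , m))
        ≡⟨ cong (lower e G z) (trans (Raise.at-e e F z (i , m) p) (ForceRightDown.second F z i m avoid fb j=i)) ⟩
      lower e G z (i , false)
        ≡⟨ Lower.at-e e G z _ p ⟩
      FromRightDown.adjust G z (i , false)
        ≡⟨ FromRightDown.second G z i false (G-avoids avoid) (apply-just (raise e) F (down z) fb)
                                (trans (raise-value e F (down z) (j , k)) j=i) ⟩
      (i , marked (raise e F (down z) (j , k)))
        ≡⟨ cong (λ l → (i , marked l)) down-raised ⟩
      (i , m) ∎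
      where
      -- the cell left of down z cannot carry j: it would complete a square
      left-avoids : Avoids F (left (down z)) j
      left-avoids c fc c=j = no-square convex local (left (down z)) fc
        (trans (cong F (trans (cong up (right-left (down z))) (up-down z))) fa) (trans c=j j=i)
      down-raised : raise e F (down z) (j , k) ≡ (j , m)
      down-raised = trans (Raise.at-e+1 e F (down z) (j , k) (trans (diag-down z) (cong sucℤ p)))
                          (FromLeftUp.second F (down z) j k left-avoids (trans (cong F (up-down z)) fa) (sym j=i))
    by-neighbours (inj₂ avoid₁) (inj₂ avoid₂) = begin
      lower e G z (raise e F z (i , m))
        ≡⟨ cong (lower e G z) (trans (Raise.at-e e F z (i , m) p) (ForceRightDown.neither F z i m avoid₁ avoid₂)) ⟩
      lower e G z (i , m)
        ≡⟨ Lower.at-e e G z _ p ⟩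
      FromRightDown.adjust G z (i , m)
        ≡⟨ FromRightDown.neither G z i m (G-avoids avoid₁) (G-avoids avoid₂) ⟩
      (i , m) ∎

  lower∘raise : ∀ {e} {F : Fill n} → Convex F → Local e F → ∀ z {a} → F z ≡ just a →
                lower e (apply (raise e) F) z (raise e F z a) ≡ a
  lower∘raise {e} {F} convex local z {i , m} fa with band (diag z) e
  ... | before-e p  = trans (cong (lower e (apply (raise e) F) z) (Raise.before e F z (i , m) p))
                            (Lower.before e (apply (raise e) F) z (i , m) p)
  ... | after-e+1 p = trans (cong (lower e (apply (raise e) F) z) (Raise.after e F z (i , m) p))
                            (Lower.after e (apply (raise e) F) z (i , m) p)
  ... | on-e+1 p    = lower∘raise-at-e+1 local z fa p
  ... | on-e p      = lower∘raise-at-e convex local z fa p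

  raise∘lower-at-e : ∀ {e} {F : Fill n} → Local (sucℤ e) F → ∀ z {i m} → F z ≡ just (i , m) →
                     diag z ≡ e → raise e (apply (lower e) F) z (lower e F z (i , m)) ≡ (i , m)
  raise∘lower-at-e {e} {F} local z {i} {m} fa p = by-neighbours (carries? F (right z) i) (carries? F (down z) i)
    where
    open Local local
    open ≡-Reasoning
    G = apply (lower e) F
    G-avoids : ∀ {w} → Avoids F w i → Avoids G w i
    G-avoids {w} = apply-avoids (lower e) (lower-value e) {F} {w}
    by-neighbours : _ → _ → raise e G z (lower e F z (i , m)) ≡ (i , m)
    -- the right neighbour carries i: the mark of z was forced on, and is restored
    by-neighbours (inj₁ (b , fb , b=i)) _ = begin
      raise e G z (lower e F z (i , m))
        ≡⟨ cong (raise e G z) (trans (Lower.at-e e F z (i , m) p) (FromRightDown.first F z i m fb b=i)) ⟩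
      raise e G z (i , marked b)
        ≡⟨ Raise.at-e e G z _ p ⟩
      ForceRightDown.adjust G z (i , marked b)
        ≡⟨ ForceRightDown.first G z i (marked b) (apply-just (lower e) F (right z) fb)
                                (trans (lower-value e F (right z) b) b=i) ⟩
      (i , true)
        ≡⟨ cong (i ,_) (sym m=true) ⟩
      (i , m) ∎
      where
      m=true : m ≡ true
      m=true = rowAbove z fa fb (sym b=i) (subst (ℤ._< sucℤ e) (sym p) (<-suc e))
    -- only the lower neighbour carries i: the mark of z was forced off
    by-neighbours (inj₂ avoid) (inj₁ (b , fb , b=i)) = begin
      raise e G z (lower e F z (i , m))
        ≡⟨ cong (raise e G z) (trans (Lower.at-e e F z (i , m) p) (FromRightDown.second F z i m avoid fb b=i)) ⟩
      raise e G z (i , marked b)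
        ≡⟨ Raise.at-e e G z _ p ⟩
      ForceRightDown.adjust G z (i , marked b)
        ≡⟨ ForceRightDown.second G z i (marked b) (G-avoids avoid) (apply-just (lower e) F (down z) fb)
                                 (trans (lower-value e F (down z) b) b=i) ⟩
      (i , false)
        ≡⟨ cong (i ,_) (sym m=false) ⟩
      (i , m) ∎
      where
      m=false : m ≡ false
      m=false = colAbove (down z) fb (trans (cong F (up-down z)) fa) b=i
                         (ℤP.≤-reflexive (trans (diag-down z) (cong sucℤ p)))
    by-neighbours (inj₂ avoid₁) (inj₂ avoid₂) = begin
      raise e G z (lower e F z (i , m))
        ≡⟨ cong (raise e G z) (trans (Lower.at-e e F z (i , m) p) (FromRightDown.neither F z i m avoid₁ avoid₂)) ⟩
      raise e G z (i , m)
        ≡⟨ Raise.at-e e G z _ p ⟩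
      ForceRightDown.adjust G z (i , m)
        ≡⟨ ForceRightDown.neither G z i m (G-avoids avoid₁) (G-avoids avoid₂) ⟩
      (i , m) ∎

  raise∘lower-at-e+1 : ∀ {e} {F : Fill n} → Convex F → Local (sucℤ e) F → ∀ z {i m} → F z ≡ just (i , m) →
                       diag z ≡ sucℤ e → raise e (apply (lower e) F) z (lower e F z (i , m)) ≡ (i , m)
  raise∘lower-at-e+1 {e} {F} convex local z {i} {m} fa p = by-neighbours (carries? F (left z) i) (carries? F (up z) i)
    where
    open ≡-Reasoning
    G = apply (lower e) F
    G-avoids : ∀ {w} → Avoids F w i → Avoids G w i
    G-avoids {w} = apply-avoids (lower e) (lower-value e) {F} {w}
    by-neighbours : _ → _ → raise e G z (lower e F z (i , m)) ≡ (i , m)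
    -- the left neighbour carries i: its lowered mark is the old mark of z
    by-neighbours (inj₁ ((j , k) , fb , j=i)) _ = begin
      raise e G z (lower e F z (i , m))
        ≡⟨ cong (raise e G z) (trans (Lower.at-e+1 e F z (i , m) p) (ForceLeftUp.first F z i m fb j=i)) ⟩
      raise e G z (i , false)
        ≡⟨ Raise.at-e+1 e G z _ p ⟩
      FromLeftUp.adjust G z (i , false)
        ≡⟨ FromLeftUp.first G z i false (apply-just (lower e) F (left z) fb)
                            (trans (lower-value e F (left z) (j , k)) j=i) ⟩
      (i , marked (lower e F (left z) (j , k)))
        ≡⟨ cong (λ l → (i , marked l)) left-lowered ⟩
      (i , m) ∎
      where
      left-lowered : lower e F (left z) (j , k) ≡ (j , m)
      left-lowered = trans (Lower.at-e e F (left z) (j , k) (suc-injective (trans (diag-left z) p)))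
                           (FromRightDown.first F (left z) j k (trans (cong F (right-left z)) fa) (sym j=i))
    -- only the upper neighbour carries i: its lowered mark is the old mark of z
    by-neighbours (inj₂ avoid) (inj₁ ((j , k) , fb , j=i)) = begin
      raise e G z (lower e F z (i , m))
        ≡⟨ cong (raise e G z) (trans (Lower.at-e+1 e F z (i , m) p) (ForceLeftUp.second F z i m avoid fb j=i)) ⟩
      raise e G z (i , true)
        ≡⟨ Raise.at-e+1 e G z _ p ⟩
      FromLeftUp.adjust G z (i , true)
        ≡⟨ FromLeftUp.second G z i true (G-avoids avoid) (apply-just (lower e) F (up z) fb)
                             (trans (lower-value e F (up z) (j , k)) j=i) ⟩
      (i , marked (lower e F (up z) (j , k)))
        ≡⟨ cong (λ l → (i , marked l)) up-lowered ⟩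
      (i , m) ∎
      where
      -- the cell right of up z cannot carry j: it would complete a square
      right-avoids : Avoids F (right (up z)) j
      right-avoids c fc c=j = no-square convex local z fa fc (trans (sym j=i) (sym c=j))
      up-lowered : lower e F (up z) (j , k) ≡ (j , m)
      up-lowered = trans (Lower.at-e e F (up z) (j , k) (suc-injective (trans (diag-up z) p)))
                         (FromRightDown.second F (up z) j k right-avoids (trans (cong F (down-up z)) fa) (sym j=i))
    by-neighbours (inj₂ avoid₁) (inj₂ avoid₂) = begin
      raise e G z (lower e F z (i , m))
        ≡⟨ cong (raise e G z) (trans (Lower.at-e+1 e F z (i , m) p) (ForceLeftUp.neither F z i m avoid₁ avoid₂)) ⟩
      raise e G z (i , m)
        ≡⟨ Raise.at-e+1 e G z _ p ⟩
      FromLeftUp.adjust G z (i , m)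
        ≡⟨ FromLeftUp.neither G z i m (G-avoids avoid₁) (G-avoids avoid₂) ⟩
      (i , m) ∎

  raise∘lower : ∀ {e} {F : Fill n} → Convex F → Local (sucℤ e) F → ∀ z {a} → F z ≡ just a →
                raise e (apply (lower e) F) z (lower e F z a) ≡ a
  raise∘lower {e} {F} convex local z {i , m} fa with band (diag z) e
  ... | before-e p  = trans (cong (raise e (apply (lower e) F) z) (Lower.before e F z (i , m) p))
                            (Raise.before e (apply (lower e) F) z (i , m) p)
  ... | after-e+1 p = trans (cong (raise e (apply (lower e) F) z) (Lower.after e F z (i , m) p))
                            (Raise.after e (apply (lower e) F) z (i , m) p)
  ... | on-e p      = raise∘lower-at-e local z fa p
  ... | on-e+1 p    = raise∘lower-at-e+1 convex local z fa p

T⇒≡true : ∀ {b} → T b → b ≡ true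
T⇒≡true = Equivalence.to T-≡

≡true⇒T : ∀ {b} → b ≡ true → T b
≡true⇒T = Equivalence.from T-≡

¬T⇒≡false : ∀ {b} → ¬ T b → b ≡ false
¬T⇒≡false ¬t = ¬-not (¬t ∘ ≡true⇒T)

∧-true : ∀ {a b} → (a ∧ b) ≡ true → (a ≡ true) × (b ≡ true)
∧-true {true} b = refl , b

=ℤ-refl : ∀ x → (x =ℤ x) ≡ true
=ℤ-refl x = trans (isYes≗does (x ℤ.≟ x)) (dec-true (x ℤ.≟ x) refl)

=ℤ-≢ : ∀ {x y} → x ≢ y → (x =ℤ y) ≡ false
=ℤ-≢ {x} {y} x≢y = trans (isYes≗does (x ℤ.≟ y)) (dec-false (x ℤ.≟ y) x≢y)

<ℤ-< : ∀ {x y} → x ℤ.< y → (x <ℤ y) ≡ true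
<ℤ-< {x} {y} lt = T⇒≡true (ℤP.≤⇒≤ᵇ (subst (ℤ._≤ y) (ℤP.+-comm 1ℤ x) (ℤP.i<j⇒suc[i]≤j lt)))

<ℤ-≮ : ∀ {x y} → ¬ (x ℤ.< y) → (x <ℤ y) ≡ false
<ℤ-≮ {x} {y} ≮ = ¬T⇒≡false (≮ ∘ ℤP.suc[i]≤j⇒i<j ∘ subst (ℤ._≤ y) (ℤP.+-comm x 1ℤ) ∘ ℤP.≤ᵇ⇒≤)

weaklyAbove-≤ : ∀ {e} z → diag z ℤ.≤ e → weaklyAbove e z ≡ true
weaklyAbove-≤ z le = T⇒≡true (ℤP.≤⇒≤ᵇ le)

weaklyAbove-> : ∀ {e} z → e ℤ.< diag z → weaklyAbove e z ≡ false
weaklyAbove-> z lt = ¬T⇒≡false (ℤP.<⇒≱ lt ∘ ℤP.≤ᵇ⇒≤)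

private
  x<x+1 : ∀ x → x ℤ.< x ℤ.+ 1ℤ
  x<x+1 x = subst (x ℤ.<_) (ℤP.+-comm 1ℤ x) (<-suc x)

  ≤ᵇ⇒≤ : ∀ {a b} → (a ℕ.≤ᵇ b) ≡ true → a ℕ.≤ b
  ≤ᵇ⇒≤ {a} {b} le = ℕP.≤ᵇ⇒≤ a b (≡true⇒T le)

  ≤⇒≤ᵇ : ∀ {a b} → a ℕ.≤ b → (a ℕ.≤ᵇ b) ≡ true
  ≤⇒≤ᵇ le = T⇒≡true (ℕP.≤⇒≤ᵇ le)

  -- reading a marking condition for a pair of cells in the other order
  swap : ∀ {n} {p q : Letter n} {b b′} → b ≡ b′ → (q ≡ p → marked q ≡ b) → p ≡ q → marked p ≡ b′
  swap b=b′ h refl = trans (h refl) b=b′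

bothAbove : ℤ → Cell → Cell → Bool
bothAbove e z₁ z₂ = weaklyAbove e z₁ ∧ weaklyAbove e z₂

module _ {n : ℕ} where

  private
    bit : Bool → ℕ
    bit m = if m then 0 else 1

    bit≤1 : ∀ m → bit m ℕ.≤ 1
    bit≤1 true  = z≤n
    bit≤1 false = s≤s z≤n

  rank-< : ∀ {i j : Fin n} m k → toℕ i ℕ.< toℕ j → rank (i , m) ℕ.< rank (j , k)
  rank-< {i} {j} m k i<j = begin-strict
    2 ℕ.* toℕ i ℕ.+ bit m    ≤⟨ ℕP.+-monoʳ-≤ (2 ℕ.* toℕ i) (bit≤1 m) ⟩
    2 ℕ.* toℕ i ℕ.+ 1        <⟨ ℕP.+-monoʳ-< (2 ℕ.* toℕ i) (ℕP.n<1+n 1) ⟩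
    2 ℕ.* toℕ i ℕ.+ 2        ≡⟨ ℕP.+-comm (2 ℕ.* toℕ i) 2 ⟩
    2 ℕ.+ 2 ℕ.* toℕ i        ≡⟨ sym (ℕP.*-suc 2 (toℕ i)) ⟩
    2 ℕ.* suc (toℕ i)        ≤⟨ ℕP.*-monoʳ-≤ 2 i<j ⟩
    2 ℕ.* toℕ j              ≤⟨ ℕP.m≤m+n (2 ℕ.* toℕ j) (bit k) ⟩
    2 ℕ.* toℕ j ℕ.+ bit k    ∎
    where open ℕP.≤-Reasoning

  rank⇒value : ∀ {a b : Letter n} → rank a ℕ.≤ rank b → a ≤ᵥ b
  rank⇒value {i , m} {j , k} le = ℕP.≮⇒≥ λ j<i → ℕP.<⇒≱ (rank-< k m j<i) le

  rank-unmarked : ∀ {i : Fin n} {k} → rank (i , false) ℕ.≤ rank (i , k) → k ≡ false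
  rank-unmarked {k = false} _  = refl
  rank-unmarked {i} {true}  le with ℕP.+-cancelˡ-≤ (2 ℕ.* toℕ i) 1 0 le
  ... | ()

  rank-marked : ∀ {i : Fin n} {m} → rank (i , m) ℕ.≤ rank (i , true) → m ≡ true
  rank-marked {m = true}  _  = refl
  rank-marked {i} {false} le = sym (rank-unmarked {i} le)

  rank-≤ : ∀ (i j : Fin n) m k → toℕ i ℕ.≤ toℕ j → (i ≡ j → m ≡ true ⊎ k ≡ false) →
           rank (i , m) ℕ.≤ rank (j , k)
  rank-≤ i j m k i≤j same with toℕ i ℕ.<? toℕ j
  ... | yes i<j = ℕP.<⇒≤ (rank-< m k i<j)
  ... | no  i≮j with FinP.toℕ-injective (ℕP.≤-antisym i≤j (ℕP.≮⇒≥ i≮j))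
  ...   | refl with same refl
  ...     | inj₁ refl = ℕP.+-monoʳ-≤ (2 ℕ.* toℕ i) z≤n
  ...     | inj₂ refl = ℕP.+-monoʳ-≤ (2 ℕ.* toℕ i) (bit≤1 m)

  sameLetter-refl : ∀ (p : Letter n) → sameLetter p p ≡ true
  sameLetter-refl (i , m)
    rewrite T⇒≡true (ℕP.≡⇒≡ᵇ (toℕ i) (toℕ i) refl)
          | isYes≗does (m Data.Bool.≟ m) | dec-true (m Data.Bool.≟ m) refl = refl
    where import Data.Bool

  sameLetter⇒≡ : ∀ {p q : Letter n} → sameLetter p q ≡ true → p ≡ q
  sameLetter⇒≡ {i , m} {j , k} same with ∧-true {toℕ i ℕ.≡ᵇ toℕ j} same
  ... | i=j , m=k = cong₂ _,_ (FinP.toℕ-injective (ℕP.≡ᵇ⇒≡ (toℕ i) (toℕ j) (≡true⇒T i=j)))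
                             (toWitness (≡true⇒T m=k))

  rowRule colRule : Bool → Letter n → Letter n → Bool
  rowRule both p q = if both then not (sameLetter p q ∧ not (marked p)) else not (sameLetter p q ∧ marked p)
  colRule both p q = if both then not (sameLetter p q ∧ marked p) else not (sameLetter p q ∧ not (marked p))

  rowRule-sound : ∀ {b} (p : Letter n) → rowRule b p p ≡ true → marked p ≡ b
  rowRule-sound {true}  (i , true)  _ = refl
  rowRule-sound {false} (i , false) _ = refl
  rowRule-sound {true}  (i , false) ok rewrite sameLetter-refl (i , false) = ok
  rowRule-sound {false} (i , true)  ok rewrite sameLetter-refl (i , true) = sym ok

  colRule-sound : ∀ {b} (p : Letter n) → colRule b p p ≡ true → marked p ≡ not b
  colRule-sound {true}  (i , false) _ = refl
  colRule-sound {false} (i , true)  _ = refl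
  colRule-sound {true}  (i , true)  ok rewrite sameLetter-refl (i , true) = sym ok
  colRule-sound {false} (i , false) ok rewrite sameLetter-refl (i , false) = ok

  rowRule-complete : ∀ b (p q : Letter n) → (p ≡ q → marked p ≡ b) → rowRule b p q ≡ true
  rowRule-complete true p q h with sameLetter p q in same
  ... | false = refl
  ... | true rewrite h (sameLetter⇒≡ same) = refl
  rowRule-complete false p q h with sameLetter p q in same
  ... | false = refl
  ... | true rewrite h (sameLetter⇒≡ same) = refl

  colRule-complete : ∀ b (p q : Letter n) → (p ≡ q → marked p ≡ not b) → colRule b p q ≡ true
  colRule-complete true p q h with sameLetter p q in same
  ... | false = refl
  ... | true rewrite h (sameLetter⇒≡ same) = refl
  colRule-complete false p q h with sameLetter p q in same
  ... | false = refl
  ... | true rewrite h (sameLetter⇒≡ same) = refl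

  pairOK-rightwards : ∀ e {x₁ x₂} y (p q : Letter n) → x₁ ℤ.< x₂ →
    pairOK e ((x₁ , y) , p) ((x₂ , y) , q) ≡
    (rank p ℕ.≤ᵇ rank q) ∧ rowRule (bothAbove e (x₁ , y) (x₂ , y)) p q
  pairOK-rightwards e y p q lt rewrite =ℤ-refl y | <ℤ-< lt | =ℤ-≢ (ℤP.<⇒≢ lt) =
    cong ((rank p ℕ.≤ᵇ rank q) ∧_) (∧-identityʳ _)

  pairOK-leftwards : ∀ e {x₁ x₂} y (p q : Letter n) → x₂ ℤ.< x₁ →
    pairOK e ((x₁ , y) , p) ((x₂ , y) , q) ≡ rowRule (bothAbove e (x₁ , y) (x₂ , y)) p q
  pairOK-leftwards e y p q gt rewrite =ℤ-refl y | <ℤ-≮ (ℤP.<-asym gt) | =ℤ-≢ (ℤP.<⇒≢ gt ∘ sym) =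
    ∧-identityʳ _

  pairOK-upwards : ∀ e x {y₁ y₂} (p q : Letter n) → y₁ ℤ.< y₂ →
    pairOK e ((x , y₁) , p) ((x , y₂) , q) ≡
    (rank p ℕ.≤ᵇ rank q) ∧ colRule (bothAbove e (x , y₁) (x , y₂)) p q
  pairOK-upwards e x p q lt rewrite =ℤ-refl x | <ℤ-< lt | =ℤ-≢ (ℤP.<⇒≢ lt) = refl

  pairOK-downwards : ∀ e x {y₁ y₂} (p q : Letter n) → y₂ ℤ.< y₁ →
    pairOK e ((x , y₁) , p) ((x , y₂) , q) ≡ colRule (bothAbove e (x , y₁) (x , y₂)) p q
  pairOK-downwards e x p q gt rewrite =ℤ-refl x | <ℤ-≮ (ℤP.<-asym gt) | =ℤ-≢ (ℤP.<⇒≢ gt ∘ sym) = refl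

  pairOK-same : ∀ e z (p q : Letter n) → pairOK e (z , p) (z , q) ≡ true
  pairOK-same e (x , y) p q
    rewrite =ℤ-refl x | =ℤ-refl y | <ℤ-≮ (ℤP.<-irrefl {x} refl) | <ℤ-≮ (ℤP.<-irrefl {y} refl) = refl

  pairOK-apart : ∀ e {x₁ x₂ y₁ y₂} (p q : Letter n) → x₁ ≢ x₂ → y₁ ≢ y₂ →
    pairOK e ((x₁ , y₁) , p) ((x₂ , y₂) , q) ≡ true
  pairOK-apart e p q x₁≢x₂ y₁≢y₂ rewrite =ℤ-≢ x₁≢x₂ | =ℤ-≢ y₁≢y₂ = refl

  Valid : ℤ → Fill n → Set
  Valid e F = ∀ z₁ z₂ {l₁ l₂} → F z₁ ≡ just l₁ → F z₂ ≡ just l₂ → pairOK e (z₁ , l₁) (z₂ , l₂) ≡ true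

  valid-right : ∀ {e F} → Valid e F → ∀ z {a b} → F z ≡ just a → F (right z) ≡ just b →
                rank a ℕ.≤ rank b × rowRule (bothAbove e z (right z)) a b ≡ true
  valid-right {e} valid (x , y) {a} {b} fa fb
    with ∧-true (trans (sym (pairOK-rightwards e y a b (x<x+1 x))) (valid _ _ fa fb))
  ... | ordered , rule = ≤ᵇ⇒≤ ordered , rule

  valid-up : ∀ {e F} → Valid e F → ∀ z {a b} → F z ≡ just a → F (up z) ≡ just b →
             rank a ℕ.≤ rank b × colRule (bothAbove e z (up z)) a b ≡ true
  valid-up {e} valid (x , y) {a} {b} fa fb
    with ∧-true (trans (sym (pairOK-upwards e x a b (x<x+1 y))) (valid _ _ fa fb))
  ... | ordered , rule = ≤ᵇ⇒≤ ordered , rule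

  valid⇒local : ∀ {e F} → Valid e F → Local e F
  valid⇒local {e} {F} valid = record
    { incRight = λ z fa fb → rank⇒value (proj₁ (valid-right valid z fa fb))
    ; incUp    = λ z fa fb → rank⇒value (proj₁ (valid-up valid z fa fb))
    ; rowAbove = rowAbove ; rowBelow = rowBelow ; colAbove = colAbove ; colBelow = colBelow }
    where
    rowAbove : ∀ z {a b} → F z ≡ just a → F (right z) ≡ just b →
               value a ≡ value b → diag z ℤ.< e → marked a ≡ true
    rowAbove z {i , true}  fa fb refl lt = refl
    rowAbove z {i , false} {_ , k} fa fb refl lt with valid-right valid z fa fb
    ... | ordered , rule with rank-unmarked {i} {k} ordered
    ...   | refl = trans (rowRule-sound (i , false) rule) above
      where
      above : bothAbove e z (right z) ≡ true
      above rewrite weaklyAbove-≤ {e} z (ℤP.<⇒≤ lt)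
                  | weaklyAbove-≤ {e} (right z) (subst (ℤ._≤ e) (sym (diag-right z)) (ℤP.i<j⇒suc[i]≤j lt)) = refl

    rowBelow : ∀ z {a b} → F z ≡ just a → F (right z) ≡ just b →
               value a ≡ value b → e ℤ.≤ diag z → marked b ≡ false
    rowBelow z {_} {i , false} fa fb refl le = refl
    rowBelow z {i , m} {_ , true} fa fb refl le with valid-right valid z fa fb
    ... | ordered , rule with rank-marked {i} {m} ordered
    ...   | refl = trans (rowRule-sound (i , true) rule) notBoth
      where
      notBoth : bothAbove e z (right z) ≡ false
      notBoth rewrite weaklyAbove-> {e} (right z) (subst (e ℤ.<_) (sym (diag-right z)) (≤⇒<-suc le)) =
        ∧-zeroʳ _

    colAbove : ∀ z {a b} → F z ≡ just a → F (up z) ≡ just b →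
               value a ≡ value b → diag z ℤ.≤ e → marked b ≡ false
    colAbove z {_} {i , false} fa fb refl le = refl
    colAbove z {i , m} {_ , true} fa fb refl le with valid-up valid z fa fb
    ... | ordered , rule with rank-marked {i} {m} ordered
    ...   | refl = trans (colRule-sound (i , true) rule) (cong not above)
      where
      above : bothAbove e z (up z) ≡ true
      above rewrite weaklyAbove-≤ {e} z le
                  | weaklyAbove-≤ {e} (up z) (ℤP.<⇒≤ (ℤP.suc[i]≤j⇒i<j (subst (ℤ._≤ e) (sym (diag-up z)) le))) = refl

    colBelow : ∀ z {a b} → F z ≡ just a → F (up z) ≡ just b →
               value a ≡ value b → e ℤ.< diag z → marked a ≡ true
    colBelow z {i , true}  fa fb refl lt = refl
    colBelow z {i , false} {_ , k} fa fb refl lt with valid-up valid z fa fb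
    ... | ordered , rule with rank-unmarked {i} {k} ordered
    ...   | refl = trans (colRule-sound (i , false) rule) (cong not notBoth)
      where
      notBoth : bothAbove e z (up z) ≡ false
      notBoth rewrite weaklyAbove-> {e} z lt = refl

private
  shift-suc : ∀ x k → x ℤ.+ +[1+ k ] ℤ.+ 1ℤ ≡ x ℤ.+ +[1+ suc k ]
  shift-suc x k = identity x +[1+ k ]
    where identity : ∀ x c → x ℤ.+ c ℤ.+ 1ℤ ≡ x ℤ.+ (1ℤ ℤ.+ c)
          identity = solve-∀

  shift-≤ : ∀ x k → x ℤ.≤ x ℤ.+ +[1+ k ]
  shift-≤ x k = ℤP.i≤i+j x +[1+ k ]

<⇒shift : ∀ {a b} → a ℤ.< b → Σ ℕ λ k → b ≡ a ℤ.+ +[1+ k ]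
<⇒shift {a} {b} lt with b ℤ.- (1ℤ ℤ.+ a) | ℤP.i≤j⇒0≤j-i (ℤP.i<j⇒suc[i]≤j lt) | identity a b
  where identity : ∀ a b → b ≡ (1ℤ ℤ.+ a) ℤ.+ (b ℤ.- (1ℤ ℤ.+ a))
        identity = solve-∀
... | + k | _ | b=a+1+k = k , trans b=a+1+k (identity a (+ k))
  where identity : ∀ a c → (1ℤ ℤ.+ a) ℤ.+ c ≡ a ℤ.+ (1ℤ ℤ.+ c)
        identity = solve-∀

diag-mono-x : ∀ {x₁ x₂} y → x₁ ℤ.≤ x₂ → diag (x₁ , y) ℤ.≤ diag (x₂ , y)
diag-mono-x y le = ℤP.+-monoˡ-≤ (ℤ.- y) le

diag-anti-y : ∀ x {y₁ y₂} → y₁ ℤ.≤ y₂ → diag (x , y₂) ℤ.≤ diag (x , y₁)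
diag-anti-y x le = ℤP.+-monoʳ-≤ x (ℤP.neg-mono-≤ le)

module _ {n : ℕ} {e : ℤ} {F : Fill n} (convex : Convex F) (local : Local e F) where
  open Local local

  row-ends : ∀ k x y {p q} → F (x , y) ≡ just p → F (x ℤ.+ +[1+ k ] , y) ≡ just q →
             p ≤ᵥ q × (value p ≡ value q → (diag (x ℤ.+ +[1+ k ] , y) ℤ.≤ e → marked p ≡ true) ×
                                           (e ℤ.< diag (x ℤ.+ +[1+ k ] , y) → marked q ≡ false))
  row-ends zero x y fp fq =
    incRight (x , y) fp fq ,
    λ p=q → (λ le → rowAbove (x , y) fp fq p=q (ℤP.suc[i]≤j⇒i<j (subst (ℤ._≤ e) (diag-right (x , y)) le))) ,
            (λ lt → rowBelow (x , y) fp fq p=q (<-suc⇒≤ (subst (e ℤ.<_) (diag-right (x , y)) lt)))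
  row-ends (suc k) x y {p} {q} fp fq
    with convex {x ℤ.+ +[1+ suc k ]} {y} {x ℤ.+ +[1+ k ]} {y} {x} {y} (p , fp) (q , fq)
                (shift-≤ x k) mid≤end ℤP.≤-refl ℤP.≤-refl
    where mid≤end = subst (x ℤ.+ +[1+ k ] ℤ.≤_) (shift-suc x k) (i≤i+1 _)
  ... | m , fm =
    ℕP.≤-trans p≤m m≤q ,
    λ p=q → let p=m = squeeze p≤m m≤q p=q in
            (λ le → proj₁ (proj₂ before p=m) (ℤP.≤-trans (ℤP.<⇒≤ diag-mid<end) le)) ,
            (λ lt → rowBelow (mid , y) fm fq′ (trans (sym p=m) p=q)
                             (<-suc⇒≤ (subst (e ℤ.<_) diag-end lt)))
    where
    mid = x ℤ.+ +[1+ k ]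
    fq′ : F (right (mid , y)) ≡ just q
    fq′ = trans (cong (λ t → F (t , y)) (shift-suc x k)) fq
    before = row-ends k x y fp fm
    p≤m = proj₁ before
    m≤q = incRight (mid , y) fm fq′
    diag-end : diag (x ℤ.+ +[1+ suc k ] , y) ≡ sucℤ (diag (mid , y))
    diag-end = trans (cong (λ t → diag (t , y)) (sym (shift-suc x k))) (diag-right (mid , y))
    diag-mid<end : diag (mid , y) ℤ.< diag (x ℤ.+ +[1+ suc k ] , y)
    diag-mid<end = subst (diag (mid , y) ℤ.<_) (sym diag-end) (<-suc _)

  col-ends : ∀ k x y {p q} → F (x , y) ≡ just p → F (x , y ℤ.+ +[1+ k ]) ≡ just q →
             p ≤ᵥ q × (value p ≡ value q → (diag (x , y) ℤ.≤ e → marked q ≡ false) ×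
                                           (e ℤ.< diag (x , y) → marked p ≡ true))
  col-ends zero x y fp fq =
    incUp (x , y) fp fq , λ p=q → colAbove (x , y) fp fq p=q , colBelow (x , y) fp fq p=q
  col-ends (suc k) x y {p} {q} fp fq
    with convex {x} {y ℤ.+ +[1+ suc k ]} {x} {y ℤ.+ +[1+ k ]} {x} {y} (p , fp) (q , fq)
                ℤP.≤-refl ℤP.≤-refl (shift-≤ y k) mid≤end
    where mid≤end = subst (y ℤ.+ +[1+ k ] ℤ.≤_) (shift-suc y k) (i≤i+1 _)
  ... | m , fm =
    ℕP.≤-trans p≤m m≤q ,
    λ p=q → let p=m = squeeze p≤m m≤q p=q in
            (λ le → colAbove (x , mid) fm fq′ (trans (sym p=m) p=q)
                             (ℤP.≤-trans (diag-anti-y x (shift-≤ y k)) le)) ,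
            proj₂ (proj₂ below p=m)
    where
    mid = y ℤ.+ +[1+ k ]
    fq′ : F (up (x , mid)) ≡ just q
    fq′ = trans (cong (λ t → F (x , t)) (shift-suc y k)) fq
    below = col-ends k x y fp fm
    p≤m = proj₁ below
    m≤q = incUp (x , mid) fm fq′

  row-pair : ∀ {x₁ x₂} y {p q} → x₁ ℤ.< x₂ → F (x₁ , y) ≡ just p → F (x₂ , y) ≡ just q →
             rank p ℕ.≤ rank q × (p ≡ q → marked p ≡ bothAbove e (x₁ , y) (x₂ , y))
  row-pair {x₁} y {i , m} {j , k} lt fp fq with <⇒shift lt
  ... | d , refl with row-ends d x₁ y fp fq | diag (x₁ ℤ.+ +[1+ d ] , y) ℤ.≤? e
  ...   | i≤j , ends | yes le =
    rank-≤ i j m k i≤j (λ i=j → inj₁ (proj₁ (ends i=j) le)) ,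
    λ { refl → trans (proj₁ (ends refl) le) (sym above) }
    where
    above : bothAbove e (x₁ , y) (x₁ ℤ.+ +[1+ d ] , y) ≡ true
    above rewrite weaklyAbove-≤ {e} (x₁ , y) (ℤP.≤-trans (diag-mono-x y (shift-≤ x₁ d)) le)
                | weaklyAbove-≤ {e} (x₁ ℤ.+ +[1+ d ] , y) le = refl
  ...   | i≤j , ends | no nle =
    rank-≤ i j m k i≤j (λ i=j → inj₂ (proj₂ (ends i=j) (ℤP.≰⇒> nle))) ,
    λ { refl → trans (proj₂ (ends refl) (ℤP.≰⇒> nle)) (sym notBoth) }
    where
    notBoth : bothAbove e (x₁ , y) (x₁ ℤ.+ +[1+ d ] , y) ≡ false
    notBoth rewrite weaklyAbove-> {e} (x₁ ℤ.+ +[1+ d ] , y) (ℤP.≰⇒> nle) = ∧-zeroʳ _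

  col-pair : ∀ x {y₁ y₂} {p q} → y₁ ℤ.< y₂ → F (x , y₁) ≡ just p → F (x , y₂) ≡ just q →
             rank p ℕ.≤ rank q × (p ≡ q → marked p ≡ not (bothAbove e (x , y₁) (x , y₂)))
  col-pair x {y₁} {_} {i , m} {j , k} lt fp fq with <⇒shift lt
  ... | d , refl with col-ends d x y₁ fp fq | diag (x , y₁) ℤ.≤? e
  ...   | i≤j , ends | yes le =
    rank-≤ i j m k i≤j (λ i=j → inj₂ (proj₁ (ends i=j) le)) ,
    λ { refl → trans (proj₁ (ends refl) le) (sym (cong not above)) }
    where
    above : bothAbove e (x , y₁) (x , y₁ ℤ.+ +[1+ d ]) ≡ true
    above rewrite weaklyAbove-≤ {e} (x , y₁) le
                | weaklyAbove-≤ {e} (x , y₁ ℤ.+ +[1+ d ]) (ℤP.≤-trans (diag-anti-y x (shift-≤ y₁ d)) le) = refl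
  ...   | i≤j , ends | no nle =
    rank-≤ i j m k i≤j (λ i=j → inj₁ (proj₂ (ends i=j) (ℤP.≰⇒> nle))) ,
    λ { refl → trans (proj₂ (ends refl) (ℤP.≰⇒> nle)) (sym (cong not notBoth)) }
    where
    notBoth : bothAbove e (x , y₁) (x , y₁ ℤ.+ +[1+ d ]) ≡ false
    notBoth rewrite weaklyAbove-> {e} (x , y₁) (ℤP.≰⇒> nle) = refl

  -- A convex locally folded filling is valid: the local conditions
  -- propagate along rows and columns.
  valid-at : ∀ {x₁ x₂ y₁ y₂ p q} → Dec (x₁ ≡ x₂) → Dec (y₁ ≡ y₂) →
             F (x₁ , y₁) ≡ just p → F (x₂ , y₂) ≡ just q → pairOK e ((x₁ , y₁) , p) ((x₂ , y₂) , q) ≡ true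
  valid-at {x₁} {y₁ = y₁} {p = p} {q} (yes refl) (yes refl) f₁ f₂ = pairOK-same e (x₁ , y₁) p q
  valid-at {p = p} {q} (no x₁≢x₂) (no y₁≢y₂) f₁ f₂ = pairOK-apart e p q x₁≢x₂ y₁≢y₂
  valid-at {x₁} {x₂} {y₁} {p = p} {q} (no x₁≢x₂) (yes refl) f₁ f₂ with ℤP.<-cmp x₁ x₂
  ... | tri< lt _ _ = trans (pairOK-rightwards e y₁ p q lt)
                            (cong₂ _∧_ (≤⇒≤ᵇ (proj₁ pair)) (rowRule-complete _ p q (proj₂ pair)))
    where pair = row-pair y₁ lt f₁ f₂
  ... | tri≈ _ eq _ = ⊥-elim (x₁≢x₂ eq)
  ... | tri> _ _ gt = trans (pairOK-leftwards e y₁ p q gt)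
                            (rowRule-complete _ p q (swap (∧-comm (weaklyAbove e (x₂ , y₁)) (weaklyAbove e (x₁ , y₁)))
                                                             (proj₂ (row-pair y₁ gt f₂ f₁))))
  valid-at {x₁} {y₁ = y₁} {y₂} {p} {q} (yes refl) (no y₁≢y₂) f₁ f₂ with ℤP.<-cmp y₁ y₂
  ... | tri< lt _ _ = trans (pairOK-upwards e x₁ p q lt)
                            (cong₂ _∧_ (≤⇒≤ᵇ (proj₁ pair)) (colRule-complete _ p q (proj₂ pair)))
    where pair = col-pair x₁ lt f₁ f₂
  ... | tri≈ _ eq _ = ⊥-elim (y₁≢y₂ eq)
  ... | tri> _ _ gt = trans (pairOK-downwards e x₁ p q gt)
                            (colRule-complete _ p q (swap (cong not (∧-comm (weaklyAbove e (x₁ , y₂)) (weaklyAbove e (x₁ , y₁))))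
                                                             (proj₂ (col-pair x₁ gt f₂ f₁))))

  local⇒valid : Valid e F
  local⇒valid (x₁ , y₁) (x₂ , y₂) = valid-at (x₁ ℤ.≟ x₂) (y₁ ℤ.≟ y₂)

module _ {A : Set} where

  injection-length : (f : A → A) (xs ys : List A) → Unique xs → (∀ {x} → x ∈ xs → f x ∈ ys) →
                     (∀ {x y} → x ∈ xs → y ∈ xs → f x ≡ f y → x ≡ y) → length xs ≤ length ys
  injection-length f [] ys _ _ _ = z≤n
  injection-length f (x ∷ xs) ys (x∉xs ∷ unique) into injective with ∈-∃++ (into (here refl))
  ... | ys₁ , ys₂ , refl = begin
    suc (length xs)              ≤⟨ s≤s (injection-length f xs (ys₁ ++ ys₂) unique into′ injective′) ⟩
    suc (length (ys₁ ++ ys₂))    ≡⟨ cong suc (ListP.length-++ ys₁) ⟩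
    suc (length ys₁ ℕ.+ length ys₂) ≡⟨ sym (ℕP.+-suc (length ys₁) (length ys₂)) ⟩
    length ys₁ ℕ.+ suc (length ys₂) ≡⟨ sym (ListP.length-++ ys₁) ⟩
    length (ys₁ ++ f x ∷ ys₂)    ∎
    where
    open ℕP.≤-Reasoning
    injective′ : ∀ {a b} → a ∈ xs → b ∈ xs → f a ≡ f b → a ≡ b
    injective′ a∈ b∈ = injective (there a∈) (there b∈)
    -- f x was removed, and no other element of xs is sent to it
    into′ : ∀ {y} → y ∈ xs → f y ∈ ys₁ ++ ys₂
    into′ {y} y∈ with ∈-++⁻ ys₁ (into (there y∈))
    ... | inj₁ p         = ∈-++⁺ˡ p
    ... | inj₂ (here eq) = ⊥-elim (All.lookup x∉xs y∈ (injective (here refl) (there y∈) (sym eq)))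
    ... | inj₂ (there p) = ∈-++⁺ʳ ys₁ p

  Maps : List A → (R S : A → Bool) (h h′ : A → A) → Set
  Maps L R S h h′ = ∀ {x} → x ∈ L → R x ≡ true → h x ∈ L × S (h x) ≡ true × h′ (h x) ≡ x

  filter-bijection : (L : List A) → Unique L → (P Q : A → Bool) (f g : A → A) →
    Maps L P Q f g → Maps L Q P g f → length (filterᵇ P L) ≡ length (filterᵇ Q L)
  filter-bijection L unique P Q f g forth back = ℕP.≤-antisym
    (injection-length f (filterᵇ P L) (filterᵇ Q L) (filtered P) (into P Q f g forth) (injective P Q f g forth))
    (injection-length g (filterᵇ Q L) (filterᵇ P L) (filtered Q) (into Q P g f back) (injective Q P g f back))
    where
    filtered : ∀ R → Unique (filterᵇ R L)
    filtered R = UniqueP.filter⁺ (T? ∘ R) unique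

    member : ∀ R {x} → x ∈ filterᵇ R L → x ∈ L × R x ≡ true
    member R x∈ with ∈-filter⁻ (T? ∘ R) x∈
    ... | x∈L , Rx = x∈L , Equivalence.to T-≡ Rx

    into : ∀ R S (h h′ : A → A) → Maps L R S h h′ →
           ∀ {x} → x ∈ filterᵇ R L → h x ∈ filterᵇ S L
    into R S h h′ maps x∈ with maps (proj₁ (member R x∈)) (proj₂ (member R x∈))
    ... | hx∈L , Shx , _ = ∈-filter⁺ (T? ∘ S) hx∈L (Equivalence.from T-≡ Shx)

    injective : ∀ R S (h h′ : A → A) → Maps L R S h h′ →
                ∀ {x y} → x ∈ filterᵇ R L → y ∈ filterᵇ R L → h x ≡ h y → x ≡ y
    injective R S h h′ maps x∈ y∈ hx=hy =
      trans (sym (back-to x∈)) (trans (cong h′ hx=hy) (back-to y∈))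
      where
      back-to : ∀ {x} → x ∈ filterᵇ R L → h′ (h x) ≡ x
      back-to x∈ = proj₂ (proj₂ (maps (proj₁ (member R x∈)) (proj₂ (member R x∈))))

module _ {n : ℕ} where

  letter∈ : ∀ (l : Letter n) → l ∈ allLetters n
  letter∈ (i , true)  = ∈-cartesianProduct⁺ (∈-allFin i) (here refl)
  letter∈ (i , false) = ∈-cartesianProduct⁺ (∈-allFin i) (there (here refl))

  letters-unique : Unique (allLetters n)
  letters-unique = UniqueP.cartesianProduct⁺ (UniqueP.allFin⁺ n) (((λ ()) ∷ []) ∷ ([] ∷ []))

  private
    extensions : List (Letter n) → List (List (Letter n))
    extensions w = map (_∷ w) (allLetters n)

  word∈ : ∀ (w : List (Letter n)) → w ∈ allWords n (length w)
  word∈ []      = here refl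
  word∈ (l ∷ w) = ∈-concatMap⁺ extensions (Any.map (λ { refl → ∈-map⁺ (_∷ w) (letter∈ l) }) (word∈ w))

  word-length : ∀ m {w : List (Letter n)} → w ∈ allWords n m → length w ≡ m
  word-length zero (here refl) = refl
  word-length (suc m) w∈ with find (∈-concatMap⁻ extensions {xs = allWords n m} w∈)
  ... | w′ , w′∈ , p with ∈-map⁻ (_∷ w′) p
  ...   | _ , _ , refl = cong suc (word-length m w′∈)

  words-unique : ∀ m → Unique (allWords n m)
  words-unique zero    = [] ∷ []
  words-unique (suc m) =
    UniqueP.concat⁺ (AllP.map⁺ (All.tabulate λ _ → UniqueP.map⁺ ListP.∷-injectiveˡ letters-unique))
                    (AllPairsP.map⁺ (AllPairs.map disjoint (words-unique m)))
    where
    disjoint : ∀ {w₁ w₂} → w₁ ≢ w₂ → Disjoint (extensions w₁) (extensions w₂)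
    disjoint w₁≢w₂ (p , q) with ∈-map⁻ _ p | ∈-map⁻ _ q
    ... | _ , _ , refl | _ , _ , eq = w₁≢w₂ (proj₂ (ListP.∷-injective eq))

_≟ᶜ_ : (z w : Cell) → Dec (z ≡ w)
_≟ᶜ_ = ProductP.≡-dec ℤ._≟_ ℤ._≟_

module _ {n : ℕ} where

  -- The filling described by a list of filled cells; the first entry for a
  -- cell counts.
  fillOf : List (Cell × Letter n) → Fill n
  fillOf []            z = nothing
  fillOf ((c , l) ∷ f) z with c ≟ᶜ z
  ... | yes _ = just l
  ... | no  _ = fillOf f z

  fillOf-sound : ∀ f z {l} → fillOf f z ≡ just l → (z , l) ∈ f
  fillOf-sound ((c , l′) ∷ f) z eq with c ≟ᶜ z
  fillOf-sound ((c , l′) ∷ f) .c refl | yes refl = here refl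
  ... | no _ = there (fillOf-sound f z eq)

  fillOf-filled : ∀ f z {l} → (z , l) ∈ f → Filled (fillOf f) z
  fillOf-filled ((c , l′) ∷ f) z p with c ≟ᶜ z
  ... | yes _ = l′ , refl
  fillOf-filled ((c , l′) ∷ f) z (here refl) | no c≢z = ⊥-elim (c≢z refl)
  fillOf-filled ((c , l′) ∷ f) z (there p)   | no _   = fillOf-filled f z p

  fillOf-unique : ∀ f z {l} → Unique (map proj₁ f) → (z , l) ∈ f → fillOf f z ≡ just l
  fillOf-unique ((c , l′) ∷ f) z u p with c ≟ᶜ z
  fillOf-unique ((c , l′) ∷ f) z u (here refl) | yes _ = refl
  fillOf-unique ((c , l′) ∷ f) z (c∉ ∷ u) (there p) | yes refl = ⊥-elim (All.lookup c∉ (∈-map⁺ proj₁ p) refl)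
  fillOf-unique ((c , l′) ∷ f) z u (here refl) | no c≢z = ⊥-elim (c≢z refl)
  fillOf-unique ((c , l′) ∷ f) z (_ ∷ u) (there p) | no _ = fillOf-unique f z u p

  fillOf-map : ∀ (t : Toggle) F f z →
               fillOf (map (λ p → (proj₁ p , t F (proj₁ p) (proj₂ p))) f) z ≡ Maybe.map (t F z) (fillOf f z)
  fillOf-map t F []            z = refl
  fillOf-map t F ((c , l) ∷ f) z with c ≟ᶜ z
  ... | yes refl = refl
  ... | no _     = fillOf-map t F f z

  all-∈ : ∀ {A : Set} (p : A → Bool) xs {x} → all p xs ≡ true → x ∈ xs → p x ≡ true
  all-∈ p (y ∷ xs) ok (here refl) = proj₁ (∧-true ok)
  all-∈ p (y ∷ xs) ok (there x∈)  = all-∈ p xs (proj₂ (∧-true {p y} ok)) x∈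

  ∈-all : ∀ {A : Set} (p : A → Bool) xs → (∀ {x} → x ∈ xs → p x ≡ true) → all p xs ≡ true
  ∈-all p []       _   = refl
  ∈-all p (y ∷ xs) every rewrite every (here refl) = ∈-all p xs (every ∘ there)

  isSSFT⇒valid : ∀ e f → isSSFT e f ≡ true → Valid e (fillOf f)
  isSSFT⇒valid e f ok z₁ z₂ {l₁} f₁ f₂ =
    all-∈ (pairOK e (z₁ , l₁)) f (all-∈ (λ p → all (pairOK e p) f) f ok (fillOf-sound f z₁ f₁))
          (fillOf-sound f z₂ f₂)

  valid⇒isSSFT : ∀ e f → Unique (map proj₁ f) → Valid e (fillOf f) → isSSFT e f ≡ true
  valid⇒isSSFT e f u valid = ∈-all _ f λ {p} p∈ → ∈-all _ f λ {q} q∈ →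
    valid (proj₁ p) (proj₁ q) (fillOf-unique f (proj₁ p) u p∈) (fillOf-unique f (proj₁ q) u q∈)

  occurrences-map : ∀ (h : Cell × Letter n → Cell × Letter n) → (∀ p → value (proj₂ (h p)) ≡ value (proj₂ p)) →
                    ∀ i f → occurrences i (map h f) ≡ occurrences i f
  occurrences-map h same i []      = refl
  occurrences-map h same i (p ∷ f) rewrite same p with toℕ (value (proj₂ p)) ℕ.≡ᵇ toℕ i
  ... | true  = cong suc (occurrences-map h same i f)
  ... | false = occurrences-map h same i f

  hasContent-map : ∀ (c : Vec ℕ n) (h : Cell × Letter n → Cell × Letter n) →
                   (∀ p → value (proj₂ (h p)) ≡ value (proj₂ p)) → ∀ f → hasContent c (map h f) ≡ hasContent c f
  hasContent-map c h same f = all-cong (allFin n) λ i → cong (ℕ._≡ᵇ lookup c i) (occurrences-map h same i f)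
    where
    all-cong : ∀ {A : Set} {p q : A → Bool} xs → (∀ x → p x ≡ q x) → all p xs ≡ all q xs
    all-cong []       _   = refl
    all-cong (x ∷ xs) p=q = cong₂ _∧_ (p=q x) (all-cong xs p=q)

private
  +-cancelˡ-≡ : ∀ a {p q} → a ℤ.+ p ≡ a ℤ.+ q → p ≡ q
  +-cancelˡ-≡ a {p} {q} eq = trans (sym (identity a p)) (trans (cong (λ t → (ℤ.- a) ℤ.+ t) eq) (identity a q))
    where identity : ∀ a p → (ℤ.- a) ℤ.+ (a ℤ.+ p) ≡ p
          identity = solve-∀

  +-cancelˡ-≤ : ∀ a {p q} → a ℤ.+ p ℤ.≤ a ℤ.+ q → p ℤ.≤ q
  +-cancelˡ-≤ a {p} {q} le = subst₂ ℤ._≤_ (identity a p) (identity a q) (ℤP.+-monoʳ-≤ (ℤ.- a) le)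
    where identity : ∀ a p → (ℤ.- a) ℤ.+ (a ℤ.+ p) ≡ p
          identity = solve-∀

  next-row : ∀ b i → (b ℤ.+ + 1) ℤ.+ + i ≡ b ℤ.+ + suc i
  next-row b i = identity b (+ i)
    where identity : ∀ b c → (b ℤ.+ 1ℤ) ℤ.+ c ≡ b ℤ.+ (1ℤ ℤ.+ c)
          identity = solve-∀

  ≤⇒shift : ∀ {a x} → a ℤ.≤ x → Σ ℕ λ j → x ≡ a ℤ.+ + j
  ≤⇒shift {a} {x} le with x ℤ.- a | ℤP.i≤j⇒0≤j-i le | identity a x
    where identity : ∀ a x → x ≡ a ℤ.+ (x ℤ.- a)
          identity = solve-∀
  ... | + j | _ | eq = j , eq

-- Row lengths of a diagram, zero beyond its last row.
rowLength : List ℕ → ℕ → ℕ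
rowLength []       _       = 0
rowLength (l ∷ ls) zero    = l
rowLength (l ∷ ls) (suc i) = rowLength ls i

InDiagram : ℤ → ℤ → List ℕ → Cell → Set
InDiagram a b ls (x , y) =
  Σ ℕ λ i → Σ ℕ λ j → j ℕ.< rowLength ls i × x ≡ a ℤ.+ + j × y ≡ b ℤ.+ + i

rowCells-sound : ∀ x₀ y l {z} → z ∈ rowCells x₀ y l → Σ ℕ λ j → j ℕ.< l × z ≡ (x₀ ℤ.+ + j , y)
rowCells-sound x₀ y (suc l) z∈ with ∈-++⁻ (rowCells x₀ y l) z∈
... | inj₁ p with rowCells-sound x₀ y l p
...   | j , j<l , eq = j , ℕP.m<n⇒m<1+n j<l , eq
rowCells-sound x₀ y (suc l) z∈ | inj₂ (here refl) = l , ℕP.≤-refl , refl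

rowCells-complete : ∀ x₀ y l j → j ℕ.< l → (x₀ ℤ.+ + j , y) ∈ rowCells x₀ y l
rowCells-complete x₀ y (suc l) j j<1+l with j ℕ.≟ l
... | yes refl = ∈-++⁺ʳ (rowCells x₀ y l) (here refl)
... | no  j≢l  = ∈-++⁺ˡ (rowCells-complete x₀ y l j (ℕP.≤∧≢⇒< (ℕP.≤-pred j<1+l) j≢l))

cellsOf-sound : ∀ a b ls {z} → z ∈ cellsOf a b ls → InDiagram a b ls z
cellsOf-sound a b (l ∷ ls) {x , y} z∈ with ∈-++⁻ (rowCells a b l) z∈
... | inj₁ p with rowCells-sound a b l p
...   | j , j<l , refl = 0 , j , j<l , refl , sym (ℤP.+-identityʳ b)
cellsOf-sound a b (l ∷ ls) {x , y} z∈ | inj₂ p with cellsOf-sound a (b ℤ.+ + 1) ls p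
... | i , j , j<l , x= , y= = suc i , j , j<l , x= , trans y= (next-row b i)

cellsOf-complete : ∀ a b ls {z} → InDiagram a b ls z → z ∈ cellsOf a b ls
cellsOf-complete a b (l ∷ ls) (zero , j , j<l , refl , refl) =
  ∈-++⁺ˡ (subst (λ y → (a ℤ.+ + j , y) ∈ rowCells a b l) (sym (ℤP.+-identityʳ b)) (rowCells-complete a b l j j<l))
cellsOf-complete a b (l ∷ ls) (suc i , j , j<l , refl , refl) =
  ∈-++⁺ʳ (rowCells a b l) (subst (λ y → (a ℤ.+ + j , y) ∈ cellsOf a (b ℤ.+ + 1) ls) (next-row b i)
                                 (cellsOf-complete a (b ℤ.+ + 1) ls (i , j , j<l , refl , refl)))

rowCells-unique : ∀ x₀ y l → Unique (rowCells x₀ y l)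
rowCells-unique x₀ y zero    = []
rowCells-unique x₀ y (suc l) = UniqueP.++⁺ (rowCells-unique x₀ y l) ([] ∷ []) last-new
  where
  last-new : ∀ {z} → ¬ (z ∈ rowCells x₀ y l × z ∈ (x₀ ℤ.+ + l , y) ∷ [])
  last-new (p , here refl) with rowCells-sound x₀ y l p
  ... | j , j<l , eq = ℕP.<-irrefl (ℤP.+-injective (+-cancelˡ-≡ x₀ (cong proj₁ (sym eq)))) j<l

cellsOf-unique : ∀ a b ls → Unique (cellsOf a b ls)
cellsOf-unique a b []       = []
cellsOf-unique a b (l ∷ ls) = UniqueP.++⁺ (rowCells-unique a b l) (cellsOf-unique a (b ℤ.+ + 1) ls) rows-apart
  where
  higher : ∀ i → b ℤ.< (b ℤ.+ + 1) ℤ.+ + i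
  higher i = subst₂ ℤ._<_ (ℤP.+-identityʳ b) (sym (next-row b i)) (ℤP.+-monoʳ-< b (ℤ.+<+ (s≤s z≤n)))

  -- the first row lies strictly below the others
  rows-apart : ∀ {z} → ¬ (z ∈ rowCells a b l × z ∈ cellsOf a (b ℤ.+ + 1) ls)
  rows-apart (p , q) with rowCells-sound a b l p | cellsOf-sound a (b ℤ.+ + 1) ls q
  ... | _ , _ , refl | i , _ , _ , _ , y= =
    ℤP.<-irrefl refl (subst (b ℤ.<_) (sym y=) (higher i))

rowLength-step : ∀ {ls} → IsPartition ls → ∀ i → rowLength ls (suc i) ℕ.≤ rowLength ls i
rowLength-step Linked.[]          _       = z≤n
rowLength-step Linked.[-]         _       = z≤n
rowLength-step (l≥l′ Linked.∷ _)  zero    = l≥l′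
rowLength-step (_ Linked.∷ rest)  (suc i) = rowLength-step rest i

rowLength-anti : ∀ {ls} → IsPartition ls → ∀ {i′ i} → i′ ℕ.≤ i → rowLength ls i ℕ.≤ rowLength ls i′
rowLength-anti part {i = zero}  z≤n  = ℕP.≤-refl
rowLength-anti part {i = suc i} i′≤i with ℕP.m≤n⇒m<n∨m≡n i′≤i
... | inj₁ i′<1+i = ℕP.≤-trans (rowLength-step part i) (rowLength-anti part (ℕP.m<1+n⇒m≤n i′<1+i))
... | inj₂ refl   = ℕP.≤-refl

cellsOf-closed : ∀ a b ls → IsPartition ls → ∀ {x y x′ y′ x″ y″} →
                 (x″ , y″) ∈ cellsOf a b ls → (x , y) ∈ cellsOf a b ls →
                 x″ ℤ.≤ x′ → x′ ℤ.≤ x → y″ ℤ.≤ y′ → y′ ℤ.≤ y → (x′ , y′) ∈ cellsOf a b ls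
cellsOf-closed a b ls part p q x″≤x′ x′≤x y″≤y′ y′≤y
  with cellsOf-sound a b ls p | cellsOf-sound a b ls q
... | i″ , j″ , _ , refl , refl | i , j , j<row , refl , refl
  with ≤⇒shift (ℤP.≤-trans (ℤP.i≤i+j a (+ j″)) x″≤x′) | ≤⇒shift (ℤP.≤-trans (ℤP.i≤i+j b (+ i″)) y″≤y′)
... | j′ , refl | i′ , refl =
  cellsOf-complete a b ls (i′ , j′ , ℕP.<-≤-trans (ℕP.≤-<-trans j′≤j j<row) (rowLength-anti part i′≤i) , refl , refl)
  where
  j′≤j = ℤP.drop‿+≤+ (+-cancelˡ-≤ a x′≤x)
  i′≤i = ℤP.drop‿+≤+ (+-cancelˡ-≤ b y′≤y)

module _ {A B : Set} where

  zip-map : ∀ (xs : List A) (ys : List B) (k : A × B → B) →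
            zip xs (map k (zip xs ys)) ≡ map (λ p → (proj₁ p , k p)) (zip xs ys)
  zip-map []       _        k = refl
  zip-map (x ∷ xs) []       k = refl
  zip-map (x ∷ xs) (y ∷ ys) k = cong ((x , k (x , y)) ∷_) (zip-map xs ys k)

  map-proj₁-zip : ∀ (xs : List A) (ys : List B) → length ys ≡ length xs → map proj₁ (zip xs ys) ≡ xs
  map-proj₁-zip []       []       _   = refl
  map-proj₁-zip (x ∷ xs) (y ∷ ys) len = cong (x ∷_) (map-proj₁-zip xs ys (ℕP.suc-injective len))

  map-proj₂-zip : ∀ (xs : List A) (ys : List B) → length ys ≡ length xs → map proj₂ (zip xs ys) ≡ ys
  map-proj₂-zip []       []       _   = refl
  map-proj₂-zip (x ∷ xs) (y ∷ ys) len = cong (y ∷_) (map-proj₂-zip xs ys (ℕP.suc-injective len))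

record Diagram (γ : List Cell) : Set where
  field
    unique : Unique γ
    closed : ∀ {x y x′ y′ x″ y″} → (x″ , y″) ∈ γ → (x , y) ∈ γ →
             x″ ℤ.≤ x′ → x′ ℤ.≤ x → y″ ℤ.≤ y′ → y′ ℤ.≤ y → (x′ , y′) ∈ γ

translatedYoung : ∀ a b ls → IsPartition ls → Diagram (cellsOf a b ls)
translatedYoung a b ls part = record { unique = cellsOf-unique a b ls ; closed = cellsOf-closed a b ls part }

module Step {n : ℕ} {γ : List Cell} (diagram : Diagram γ) (c : Vec ℕ n) where
  open Diagram diagram

  Word : Set
  Word = List (Letter n)

  fillWith : Word → Fill n
  fillWith w = fillOf (zip γ w)

  IsTableau : ℤ → Word → Bool
  IsTableau e w = isSSFT e (zip γ w) ∧ hasContent c (zip γ w)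

  retoggle : Toggle → Word → Word
  retoggle t w = map (λ p → t (fillWith w) (proj₁ p) (proj₂ p)) (zip γ w)

  cells-unique : ∀ {w : Word} → length w ≡ length γ → Unique (map proj₁ (zip γ w))
  cells-unique {w} len = subst Unique (sym (map-proj₁-zip γ w len)) unique

  filled⇒∈ : ∀ {w : Word} → length w ≡ length γ → ∀ {z} → Filled (fillWith w) z → z ∈ γ
  filled⇒∈ {w} len {z} (l , eq) = subst (z ∈_) (map-proj₁-zip γ w len) (∈-map⁺ proj₁ (fillOf-sound (zip γ w) z eq))

  ∈⇒filled : ∀ {w : Word} → length w ≡ length γ → ∀ {z} → z ∈ γ → Filled (fillWith w) z
  ∈⇒filled {w} len {z} z∈ with ∈-map⁻ proj₁ (subst (z ∈_) (sym (map-proj₁-zip γ w len)) z∈)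
  ... | (_ , l) , p∈ , refl = fillOf-filled (zip γ w) z p∈

  fillWith-convex : ∀ {w : Word} → length w ≡ length γ → Convex (fillWith w)
  fillWith-convex len f″ f x″≤x′ x′≤x y″≤y′ y′≤y =
    ∈⇒filled len (closed (filled⇒∈ len f″) (filled⇒∈ len f) x″≤x′ x′≤x y″≤y′ y′≤y)

  retoggle-length : ∀ t {w : Word} → length w ≡ length γ → length (retoggle t w) ≡ length γ
  retoggle-length t {w} len = trans (ListP.length-map _ (zip γ w))
                                  (trans (ListP.length-zipWith _,_ γ w) (trans (cong (length γ ℕ.⊓_) len) (ℕP.⊓-idem _)))

  fillWith-retoggle : ∀ t (w : Word) z → fillWith (retoggle t w) z ≡ apply t (fillWith w) z
  fillWith-retoggle t w z = trans (cong (λ f → fillOf f z) (zip-map γ w _)) (fillOf-map t (fillWith w) (zip γ w) z)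

  tableau⇒local : ∀ {e} {w : Word} → IsTableau e w ≡ true → Local e (fillWith w)
  tableau⇒local {e} {w} tableau = valid⇒local (isSSFT⇒valid e (zip γ w) (proj₁ (∧-true tableau)))

  retoggle-tableau : ∀ t {e′} {w : Word} → length w ≡ length γ → ValuePreserving t → Local e′ (apply t (fillWith w)) →
                     hasContent c (zip γ w) ≡ true → IsTableau e′ (retoggle t w) ≡ true
  retoggle-tableau t {e′} {w} len preserve local content = cong₂ _∧_ ssft content′
    where
    w′ = retoggle t w
    len′ = retoggle-length t len
    ssft : isSSFT e′ (zip γ w′) ≡ true
    ssft = valid⇒isSSFT e′ (zip γ w′) (cells-unique len′)
             (local⇒valid (fillWith-convex len′) (Local-cong (fillWith-retoggle t w) local))
    content′ : hasContent c (zip γ w′) ≡ true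
    content′ = trans (cong (hasContent c) (zip-map γ w _))
                     (trans (hasContent-map c _ (λ p → preserve (fillWith w) (proj₁ p) (proj₂ p)) (zip γ w)) content)

  retoggle-inverse : ∀ t t′ {w : Word} → length w ≡ length γ → Extensional t′ →
    (∀ z {a} → fillWith w z ≡ just a → t′ (apply t (fillWith w)) z (t (fillWith w) z a) ≡ a) →
    retoggle t′ (retoggle t w) ≡ w
  retoggle-inverse t t′ {w} len ext inverse = begin
    map (λ p → t′ G (proj₁ p) (proj₂ p)) (zip γ (retoggle t w))
      ≡⟨ cong (map _) (zip-map γ w _) ⟩
    map (λ p → t′ G (proj₁ p) (proj₂ p)) (map (λ p → (proj₁ p , t F (proj₁ p) (proj₂ p))) (zip γ w))
      ≡⟨ sym (ListP.map-∘ (zip γ w)) ⟩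
    map (λ p → t′ G (proj₁ p) (t F (proj₁ p) (proj₂ p))) (zip γ w)
      ≡⟨ ListP.map-cong-local (All.tabulate cellwise) ⟩
    map proj₂ (zip γ w)
      ≡⟨ map-proj₂-zip γ w len ⟩
    w ∎
    where
    open ≡-Reasoning
    F = fillWith w
    G = fillWith (retoggle t w)
    cellwise : ∀ {p} → p ∈ zip γ w → t′ G (proj₁ p) (t F (proj₁ p) (proj₂ p)) ≡ proj₂ p
    cellwise {z , a} p∈ = trans (ext (fillWith-retoggle t w) z _)
                                (inverse z (fillOf-unique (zip γ w) z (cells-unique len) p∈))

  step : ∀ e → QfCoeff γ e n c ≡ QfCoeff γ (sucℤ e) n c
  step e = filter-bijection (allWords n (length γ)) (words-unique (length γ))
             (IsTableau e) (IsTableau (sucℤ e)) (retoggle (raise e)) (retoggle (lower e)) forth back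
    where
    member : ∀ t {w : Word} → length w ≡ length γ → retoggle t w ∈ allWords n (length γ)
    member t {w} len = subst (λ m → retoggle t w ∈ allWords n m) (retoggle-length t len) (word∈ (retoggle t w))

    forth : Maps (allWords n (length γ)) (IsTableau e) (IsTableau (sucℤ e)) (retoggle (raise e)) (retoggle (lower e))
    forth w∈ tableau =
      member (raise e) len ,
      retoggle-tableau (raise e) len (raise-value e) (raise-local (fillWith-convex len) local) (proj₂ (∧-true tableau)) ,
      retoggle-inverse (raise e) (lower e) len (lower-ext e) (lower∘raise (fillWith-convex len) local)
      where
      len = word-length (length γ) w∈
      local = tableau⇒local tableau

    back : Maps (allWords n (length γ)) (IsTableau (sucℤ e)) (IsTableau e) (retoggle (lower e)) (retoggle (raise e))
    back w∈ tableau =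
      member (lower e) len ,
      retoggle-tableau (lower e) len (lower-value e) (lower-local (fillWith-convex len) local) (proj₂ (∧-true tableau)) ,
      retoggle-inverse (lower e) (raise e) len (raise-ext e) (raise∘lower (fillWith-convex len) local)
      where
      len = word-length (length γ) w∈
      local = tableau⇒local tableau

shift-invariant⇒constant : ∀ {A : Set} (f : ℤ → A) → (∀ t → f t ≡ f (sucℤ t)) → ∀ s t → f s ≡ f t
shift-invariant⇒constant f invariant s t = trans (to-zero s) (sym (to-zero t))
  where
  to-zero : ∀ t → f t ≡ f (+ 0)
  to-zero (+ zero)      = refl
  to-zero (+ suc k)     = trans (sym (invariant (+ k))) (to-zero (+ k))
  to-zero -[1+ zero ]   = invariant -[1+ 0 ]
  to-zero -[1+ suc k ]  = trans (invariant -[1+ suc k ]) (to-zero -[1+ k ])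

mainTheorem13 : (λ' : List ℕ) → IsPartition λ' → (a b : ℤ) → (e e' : ℤ) →
                (n : ℕ) → (c : Vec ℕ n) →
                QfCoeff (cellsOf a b λ') e n c ≡ QfCoeff (cellsOf a b λ') e' n c
mainTheorem13 λ' partition a b e e' n c =
  shift-invariant⇒constant (λ t → QfCoeff (cellsOf a b λ') t n c) (Step.step (translatedYoung a b λ' partition) c) e e'
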